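{- Let $R$ be a finite ring, $f=a_1x_1+\dots+a_nx_n$ a linear form over $R$, $s_f$ the size of the linear clause $\mathrm{Im}(f):=\bigvee_{A\in im_2(f)}(f=A)$, and $d_f=|im_2(f)|$. Then there is a tree-like $\mathrm{Res}(\mathrm{lin}_R)$ derivation (from the boolean axioms alone) of $\mathrm{Im}(f)$ of size $O(s_f n^{2d_f})$.
   Context: $im_2(f)$ is the set of values of $f$ under 0-1 assignments. A linear clause over $R$ is a disjunction of linear equations (duplicates identified). $\mathrm{Res}(\mathrm{lin}_R)$: boolean axioms $x=0\vee x=1$; rules resolution (from $C\vee f=0$ and $D\vee g=0$ derive $C\vee D\vee(\alpha f+\beta g=0)$, $\alpha,\beta\in R$), simplification (from $C\vee a=0$, $a\in R\setminus\{0\}$, derive $C$), weakening (from $C$ derive $C\vee g=0$). A derivation is a sequence of clauses each an axiom or derived from earlier ones by a rule; tree-like means each occurrence of a clause is used at most once as a premise. Size is total number of variable occurrences plus total size of coefficients. -}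

module Defs where

open import Level using (Level; _⊔_)
open import Algebra.Bundles using (Ring)
open import Data.Nat using (ℕ; zero; suc) renaming (_+_ to _+ℕ_)
open import Data.Fin using (Fin; zero; suc)
open import Data.Bool using (Bool; true; false; if_then_else_)
open import Data.List using (List; []; _∷_; _++_; map; length; deduplicate; concatMap)
open import Data.List.Relation.Unary.Any using (Any)
open import Data.Product using (Σ; ∃; _×_; _,_)
open import Relation.Nullary using (¬_; does)
open import Relation.Binary using (Decidable)
open import Function.Bundles using (_⇔_)

record FiniteRing (c ℓ : Level) : Set (Level.suc (c ⊔ ℓ)) where
  field
    ring  : Ring c ℓ
  open Ring ring public
  field
    _≟_   : Decidable _≈_
    card  : ℕ
    enum  : Fin card → Carrier
    enum-surj : ∀ x → ∃ λ i → enum i ≈ x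

module _ {c ℓ : Level} (R : FiniteRing c ℓ) where
  open FiniteRing R using (Carrier; _≈_; _+_; _*_; -_; 0#; 1#; _≟_)

  sumF : ∀ {n} → (Fin n → Carrier) → Carrier
  sumF {zero}  v = 0#
  sumF {suc n} v = v zero + sumF (λ i → v (suc i))

  countNZ : ∀ {n} → (Fin n → Carrier) → ℕ
  countNZ {zero}  v = 0
  countNZ {suc n} v =
    (if does (v zero ≟ 0#) then 0 else 1) +ℕ countNZ (λ i → v (suc i))

  -- A linear equation  Σ coeffs i · x_i + const = 0  in variables x_0..x_{n-1}
  record Eqn (n : ℕ) : Set c where
    constructor mkEqn
    field
      coeffs : Fin n → Carrier
      const  : Carrier
  open Eqn public

  _≈E_ : ∀ {n} → Eqn n → Eqn n → Set ℓ
  e ≈E e' = (∀ i → coeffs e i ≈ coeffs e' i) × (const e ≈ const e')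

  -- linear clause: disjunction of equations; duplicates are identified by
  -- treating clauses up to set equality (≈C below)
  Clause : ℕ → Set c
  Clause n = List (Eqn n)

  _∈C_ : ∀ {n} → Eqn n → Clause n → Set (c ⊔ ℓ)
  e ∈C C = Any (e ≈E_) C

  _≈C_ : ∀ {n} → Clause n → Clause n → Set (c ⊔ ℓ)
  C ≈C D = ∀ e → (e ∈C C) ⇔ (e ∈C D)

  lincomb : ∀ {n} → Carrier → Eqn n → Carrier → Eqn n → Eqn n
  lincomb α f β g =
    mkEqn (λ i → α * coeffs f i + β * coeffs g i) (α * const f + β * const g)

  constEqn : ∀ {n} → Carrier → Eqn n
  constEqn a = mkEqn (λ _ → 0#) a

  var : ∀ {n} → Fin n → Fin n → Carrier
  var zero    zero    = 1#
  var zero    (suc j) = 0#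
  var (suc i) zero    = 0#
  var (suc i) (suc j) = var i j

  -- boolean axiom  x_i = 0 ∨ x_i = 1   (x_i - 1 = 0)
  boolAx : ∀ {n} → Fin n → Clause n
  boolAx i = mkEqn (var i) 0# ∷ mkEqn (var i) (- 1#) ∷ []

  -- size of an equation: number of variable occurrences plus size of the
  -- coefficients (each ring element of the finite ring R has size 1; the
  -- constant term is always written)
  eqSize : ∀ {n} → Eqn n → ℕ
  eqSize e = countNZ (coeffs e) +ℕ (countNZ (coeffs e) +ℕ 1)

  clauseSize : ∀ {n} → Clause n → ℕ
  clauseSize []      = 0
  clauseSize (e ∷ C) = eqSize e +ℕ clauseSize C

  -- tree-like Res(lin_R) derivations from the boolean axioms, indexed by
  -- the derived clause (each node: a clause equal as a set to the rule output)
  data TreeDeriv {n : ℕ} : Clause n → Set (c ⊔ ℓ) where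
    axiom  : ∀ {E} (i : Fin n) → E ≈C boolAx i → TreeDeriv E
    res    : ∀ {P Q E} (C D : Clause n) (f g : Eqn n) (α β : Carrier) →
             P ≈C (f ∷ C) → Q ≈C (g ∷ D) →
             E ≈C (lincomb α f β g ∷ (C ++ D)) →
             TreeDeriv P → TreeDeriv Q → TreeDeriv E
    simp   : ∀ {P E} (C : Clause n) (a : Carrier) → ¬ (a ≈ 0#) →
             P ≈C (constEqn a ∷ C) → E ≈C C →
             TreeDeriv P → TreeDeriv E
    weak   : ∀ {P E} (g : Eqn n) → E ≈C (g ∷ P) →
             TreeDeriv P → TreeDeriv E

  derivSize : ∀ {n} {E : Clause n} → TreeDeriv E → ℕ
  derivSize {E = E} (axiom i _) = clauseSize E
  derivSize {E = E} (res _ _ _ _ _ _ _ _ _ π ρ) =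
    clauseSize E +ℕ (derivSize π +ℕ derivSize ρ)
  derivSize {E = E} (simp _ _ _ _ _ π) = clauseSize E +ℕ derivSize π
  derivSize {E = E} (weak _ _ π) = clauseSize E +ℕ derivSize π

  assignments : (n : ℕ) → List (Fin n → Bool)
  assignments zero = (λ ()) ∷ []
  assignments (suc n) =
    concatMap (λ x → (λ { zero → false ; (suc i) → x i })
                   ∷ (λ { zero → true  ; (suc i) → x i }) ∷ [])
              (assignments n)

  bit : Bool → Carrier
  bit b = if b then 1# else 0#

  evalForm : ∀ {n} → (Fin n → Carrier) → (Fin n → Bool) → Carrier
  evalForm a x = sumF (λ i → a i * bit (x i))

  im2 : ∀ {n} → (Fin n → Carrier) → List Carrier
  im2 {n} a = deduplicate _≟_ (map (evalForm a) (assignments n))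

  dF : ∀ {n} → (Fin n → Carrier) → ℕ
  dF a = length (im2 a)

  ImClause : ∀ {n} → (Fin n → Carrier) → Clause n
  ImClause a = map (λ A → mkEqn a (- A)) (im2 a)

  sF : ∀ {n} → (Fin n → Carrier) → ℕ
  sF a = clauseSize (ImClause a)

module Submission where

-- The derivation is built by divide and conquer over intervals of variables.  For a
-- single variable, Im(aⱼxⱼ) follows from the boolean axiom xⱼ = 0 ∨ xⱼ = 1 by scaling.
-- If an interval is split into two halves, on which f restricts to g and h, then
-- Im(g + h) is obtained from Im(g) and Im(h) by the combination step: chains of
-- sum-resolutions produce the equations g + h = A + B, and cuts on distinct values of
-- g merge the chains.  All image sets have at most d = d_f elements, so one step uses
-- at most 2^{2d−1} times as many nodes as each half; after ⌈log₂ n⌉ levels there are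
-- O(n^{2d−1}) nodes, each a clause of O(d²) equations of size at most 2n + 1.

open import Defs
open import Level using (Level)
open import Data.Nat using (ℕ)
open import Data.Fin using (Fin)

module Arithmetic where
  open import Data.Nat using (ℕ; zero; suc; _+_; _*_; _^_; _∸_; _≤_; z≤n; s≤s; _≤?_; >-nonZero)
  open import Data.Nat.Properties
  open import Data.Nat.Tactic.RingSolver using (solve-∀)
  open import Data.Product using (∃; _×_; _,_)
  open import Relation.Nullary using (yes; no)
  open import Relation.Binary.PropositionalEquality using (_≡_; refl; sym; cong)

  suc≤2^ : ∀ t → suc t ≤ 2 ^ t
  suc≤2^ zero    = s≤s z≤n
  suc≤2^ (suc t) = +-mono-≤ (m^n>0 2 t) (≤-trans (suc≤2^ t) (m≤m+n (2 ^ t) 0))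

  ceilLog₂ : ∀ n → 1 ≤ n → ∃ λ k → n ≤ 2 ^ k × 2 ^ k ≤ 2 * n
  ceilLog₂ (suc zero)    _ = 0 , s≤s z≤n , s≤s z≤n
  ceilLog₂ (suc (suc n)) _ with ceilLog₂ (suc n) (s≤s z≤n)
  ... | k , n≤2^k , 2^k≤2n with suc (suc n) ≤? 2 ^ k
  ...   | yes fits = k , fits , ≤-trans 2^k≤2n (*-monoʳ-≤ 2 (n≤1+n (suc n)))
  ...   | no  big  = suc k , +-mono-≤ (m^n>0 2 k) (≤-trans n≤2^k (m≤m+n (2 ^ k) 0))
                           , *-monoʳ-≤ 2 (≤-trans (≤-pred (≰⇒> big)) (n≤1+n _))

  *-distrib-^ : ∀ m p e → (m * p) ^ e ≡ m ^ e * p ^ e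
  *-distrib-^ m p zero    = refl
  *-distrib-^ m p (suc e) = begin-equality
    m * p * (m * p) ^ e       ≡⟨ cong (m * p *_) (*-distrib-^ m p e) ⟩
    m * p * (m ^ e * p ^ e)   ≡⟨ interchange m p (m ^ e) (p ^ e) ⟩
    m * m ^ e * (p * p ^ e)   ∎
    where
    open ≤-Reasoning
    interchange : ∀ a b x y → a * b * (x * y) ≡ a * x * (b * y)
    interchange = solve-∀

  -- Node count of a merging tree with 2ᵘ leaves of cost C, each merge adding two nodes.
  mergeCost : ℕ → ℕ → ℕ
  mergeCost C zero    = C
  mergeCost C (suc u) = 2 + (mergeCost C u + mergeCost C u)

  mergeCost+2 : ∀ C u → mergeCost C u + 2 ≡ 2 ^ u * (C + 2)
  mergeCost+2 C zero    = sym (*-identityˡ (C + 2))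
  mergeCost+2 C (suc u) = begin-equality
    2 + (m + m) + 2         ≡⟨ double m ⟩
    2 * (m + 2)             ≡⟨ cong (2 *_) (mergeCost+2 C u) ⟩
    2 * (2 ^ u * (C + 2))   ≡⟨ sym (*-assoc 2 (2 ^ u) (C + 2)) ⟩
    2 ^ suc u * (C + 2)     ∎
    where
    open ≤-Reasoning
    m = mergeCost C u
    double : ∀ x → 2 + (x + x) + 2 ≡ 2 * (x + 2)
    double = solve-∀

  -- If both halves use at most N nodes
  -- with N + E ≤ B, the combination step uses 1 + mergeCost((t+1)(N+1), s) nodes
  -- (chains of cost (t+1)(N+1) merged over 2ˢ leaves, plus a relabelling), and this
  -- still satisfies the invariant for the bound c·B, provided 2ˢ(t+1) ≤ c and the
  -- additive slack E absorbs the lower-order terms.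
  levelStep : ∀ s t N E B c → 1 ≤ t → 2 ^ s * (t + 3) ≤ E → 2 ^ s * suc t ≤ c → N + E ≤ B →
              suc (mergeCost (suc t * suc N) s) + E ≤ c * B
  levelStep s t N E B c 1≤t slack p≤c N+E≤B = begin
    suc m + E                            ≤⟨ +-monoˡ-≤ E (≤-trans (n≤1+n (suc m)) (≤-reflexive (+-comm 2 m))) ⟩
    (m + 2) + E                          ≡⟨ cong (_+ E) (mergeCost+2 (suc t * suc N) s) ⟩
    q * (suc t * suc N + 2) + E          ≡⟨ expand q t N E ⟩
    q * suc t * N + (q * (t + 3) + E)    ≤⟨ +-monoʳ-≤ (p * N) (+-monoˡ-≤ E slack) ⟩
    p * N + (E + E)                      ≡⟨ cong (λ x → p * N + (E + x)) (sym (+-identityʳ E)) ⟩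
    p * N + 2 * E                        ≤⟨ +-monoʳ-≤ (p * N) (*-monoˡ-≤ E 2≤p) ⟩
    p * N + p * E                        ≡⟨ sym (*-distribˡ-+ p N E) ⟩
    p * (N + E)                          ≤⟨ *-mono-≤ p≤c N+E≤B ⟩
    c * B                                ∎
    where
    open ≤-Reasoning
    q = 2 ^ s
    p = q * suc t
    m = mergeCost (suc t * suc N) s
    2≤p : 2 ≤ p
    2≤p = *-mono-≤ (m^n>0 2 s) (s≤s 1≤t)
    expand : ∀ q t N E → q * (suc t * suc N + 2) + E ≡ q * suc t * N + (q * (t + 3) + E)
    expand = solve-∀

  -- The closing estimate: a derivation with L-literal clauses over n variables and
  -- W·(2ᵉ)ᵏ nodes, where 2ᵏ ≤ 2n, has size O(nᵉ⁺¹).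
  finalBound : ∀ n k e L W K s → 1 ≤ n → 2 ^ k ≤ 2 * n → 3 * L * W * 2 ^ e ≤ K → 1 ≤ s →
               L * (n + (n + 1)) * (W * (2 ^ e) ^ k) ≤ K * s * n ^ suc e
  finalBound n k e L W K s 1≤n 2^k≤2n LW≤K 1≤s = begin
    L * (n + (n + 1)) * (W * (2 ^ e) ^ k) ≤⟨ *-mono-≤ (*-monoʳ-≤ L 3n) (*-monoʳ-≤ W powers) ⟩
    L * (3 * n) * (W * (2 ^ e * n ^ e))   ≡⟨ regroup L n W (2 ^ e) (n ^ e) ⟩
    3 * L * W * 2 ^ e * n ^ suc e         ≤⟨ *-monoˡ-≤ (n ^ suc e) LW≤K ⟩
    K * n ^ suc e                         ≤⟨ *-monoˡ-≤ (n ^ suc e) (m≤m*n K s {{>-nonZero 1≤s}}) ⟩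
    K * s * n ^ suc e                     ∎
    where
    open ≤-Reasoning
    regroup : ∀ L n W q r → L * (3 * n) * (W * (q * r)) ≡ 3 * L * W * q * (n * r)
    regroup = solve-∀
    triple : ∀ m → m + (m + m) ≡ 3 * m
    triple = solve-∀
    3n : n + (n + 1) ≤ 3 * n
    3n = begin
      n + (n + 1)       ≤⟨ +-monoʳ-≤ n (+-monoʳ-≤ n 1≤n) ⟩
      n + (n + n)       ≡⟨ triple n ⟩
      3 * n             ∎
    powers : (2 ^ e) ^ k ≤ 2 ^ e * n ^ e
    powers = begin
      (2 ^ e) ^ k       ≡⟨ ^-*-assoc 2 e k ⟩
      2 ^ (e * k)       ≡⟨ cong (2 ^_) (*-comm e k) ⟩
      2 ^ (k * e)       ≡⟨ sym (^-*-assoc 2 k e) ⟩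
      (2 ^ k) ^ e       ≤⟨ ^-monoˡ-≤ e 2^k≤2n ⟩
      (2 * n) ^ e       ≡⟨ *-distrib-^ 2 n e ⟩
      2 ^ e * n ^ e     ∎

  -- The constants of the construction, as functions of d = d_f: the maximal number of
  -- literals of a clause, the additive slack of the node-count invariant, the node budget
  -- of a single variable, and the base-2 logarithm of the growth factor per level.
  widthFor slackFor budgetFor levelExp boundConstant : ℕ → ℕ
  widthFor d = 2 + d + d * d
  slackFor d = 2 ^ d * (d + 3)
  budgetFor d = 7 + slackFor d
  levelExp d = d ∸ 1 + d
  boundConstant d = 3 * widthFor d * budgetFor d * 2 ^ levelExp d

  -- The constant grows with d; bounding d_f by |R| then gives a constant uniform in f.
  boundConstant-mono : ∀ {d d′} → d ≤ d′ → boundConstant d ≤ boundConstant d′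
  boundConstant-mono {d} {d′} d≤d′ =
    *-mono-≤ (*-mono-≤ (*-monoʳ-≤ 3 width≤) (+-monoʳ-≤ 7 slack≤))
             (^-monoʳ-≤ 2 (+-mono-≤ (∸-monoˡ-≤ 1 d≤d′) d≤d′))
    where
    width≤ : widthFor d ≤ widthFor d′
    width≤ = +-mono-≤ (+-monoʳ-≤ 2 d≤d′) (*-mono-≤ d≤d′ d≤d′)
    slack≤ : slackFor d ≤ slackFor d′
    slack≤ = *-mono-≤ (^-monoʳ-≤ 2 d≤d′) (+-monoˡ-≤ 3 d≤d′)

module ClauseCalculus {c ℓ : Level} (R : FiniteRing c ℓ) (n : ℕ) where
  open import Level using () renaming (_⊔_ to _⊔ˡ_)
  open import Data.Nat using (zero; suc; _≤_; z≤n; s≤s) renaming (_+_ to _+ℕ_; _*_ to _*ℕ_)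
  open import Data.Nat.Properties
    using (≤-trans; ≤-reflexive; +-mono-≤; +-monoˡ-≤; +-monoʳ-≤; *-monoˡ-≤; m≤n⇒m≤1+n; m≤m+n; m≤n+m;
    n≤1+n)
  import Data.Nat.Properties as ℕₚ
  import Relation.Binary.PropositionalEquality as ≡
  open import Data.Bool using (true; false)
  open import Data.List using ([]; _∷_; _++_; map; length)
  open import Data.List.Relation.Unary.Any using (here; there)
  open import Data.Product using (_,_)
  open import Data.Sum using (inj₁; inj₂)
  open import Relation.Nullary using (¬_; does)
  open import Relation.Binary.Bundles using (Setoid)
  open import Function.Bundles using (mk⇔; Equivalence)
  import Algebra.Properties.Ring as RingProperties
  import Data.List.Membership.Setoid as Membership
  import Data.List.Membership.Setoid.Properties as MembershipProperties
  import Data.List.Relation.Binary.Subset.Setoid as Subset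
  import Data.List.Relation.Binary.Subset.Setoid.Properties as SubsetProperties
  open FiniteRing R hiding (zero)
  open RingProperties ring using (-‿+-comm; -1*x≈-x; +-inverseʳ-unique; -‿involutive)

  Form : Set c
  Form = Fin n → Carrier

  Eq : Set c
  Eq = Eqn R n

  Cl : Set c
  Cl = Clause R n

  _≐_ : Form → Carrier → Eq
  v ≐ A = mkEqn v (- A)

  -- Equations up to coefficientwise equality form a setoid; clause membership _∈C_ of
  -- Defs is setoid membership for it, so the list-membership library applies.
  eqnSetoid : Setoid c ℓ
  eqnSetoid = record
    { Carrier       = Eq
    ; _≈_           = _≈E_ R
    ; isEquivalence = record
      { refl  = (λ _ → refl) , refl
      ; sym   = λ (p , q) → (λ i → sym (p i)) , sym q
      ; trans = λ (p , q) (p′ , q′) → (λ i → trans (p i) (p′ i)) , trans q q′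
      }
    }

  open Setoid eqnSetoid public using () renaming (refl to ≈ₑ-refl; sym to ≈ₑ-sym; trans to ≈ₑ-trans)
  open Membership eqnSetoid public using () renaming (_∈_ to _∈ₑ_)
  open Membership setoid public using () renaming (_∈_ to _∈ᵥ_; _∉_ to _∉ᵥ_)
  open Subset setoid public using () renaming (_⊆_ to _⊆ᵥ_)
  open MembershipProperties using (∈-resp-≈; ∈-++⁻; ∈-map⁺; ∈-map⁻)
  open Subset eqnSetoid public using (_⊆_)

  ⊆-refl : ∀ {L} → L ⊆ L
  ⊆-refl = SubsetProperties.⊆-refl eqnSetoid

  ⊆-trans : ∀ {L M N} → L ⊆ M → M ⊆ N → L ⊆ N
  ⊆-trans = SubsetProperties.⊆-trans eqnSetoid

  ⊆∷ : ∀ {e L} → L ⊆ e ∷ L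
  ⊆∷ = there

  ∷⊆ : ∀ {e L M} → e ∈ₑ M → L ⊆ M → e ∷ L ⊆ M
  ∷⊆ = SubsetProperties.∈-∷⁺ʳ eqnSetoid

  ⊆++ˡ : ∀ {L} M → L ⊆ L ++ M
  ⊆++ˡ {L} M = SubsetProperties.xs⊆xs++ys eqnSetoid L M

  ⊆++ʳ : ∀ L {M} → M ⊆ L ++ M
  ⊆++ʳ L {M} = SubsetProperties.xs⊆ys++xs eqnSetoid M L

  _≈ᶜ_ : Cl → Cl → Set (c ⊔ˡ ℓ)
  _≈ᶜ_ = _≈C_ R

  ⊆-antisym : ∀ {L M} → L ⊆ M → M ⊆ L → L ≈ᶜ M
  ⊆-antisym L⊆M M⊆L e = mk⇔ L⊆M M⊆L

  ≈ᶜ⇒⊆ : ∀ {L M} → L ≈ᶜ M → L ⊆ M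
  ≈ᶜ⇒⊆ L≈M {e} = Equivalence.to (L≈M e)

  ≈ᶜ⇒⊇ : ∀ {L M} → L ≈ᶜ M → M ⊆ L
  ≈ᶜ⇒⊇ L≈M {e} = Equivalence.from (L≈M e)

  ≈ᶜ-refl : ∀ {L} → L ≈ᶜ L
  ≈ᶜ-refl = ⊆-antisym ⊆-refl ⊆-refl

  ≈ᶜ-sym : ∀ {L M} → L ≈ᶜ M → M ≈ᶜ L
  ≈ᶜ-sym L≈M = ⊆-antisym (≈ᶜ⇒⊇ L≈M) (≈ᶜ⇒⊆ L≈M)

  ≈ᶜ-trans : ∀ {L M N} → L ≈ᶜ M → M ≈ᶜ N → L ≈ᶜ N
  ≈ᶜ-trans L≈M M≈N =
    ⊆-antisym (⊆-trans (≈ᶜ⇒⊆ L≈M) (≈ᶜ⇒⊆ M≈N)) (⊆-trans (≈ᶜ⇒⊇ M≈N) (≈ᶜ⇒⊇ L≈M))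

  ∈-head : ∀ {e L} → e ∈ₑ (e ∷ L)
  ∈-head = here ≈ₑ-refl

  []⊆ : ∀ {L} → [] ⊆ L
  []⊆ ()

  ++⊆ : ∀ {L L′ M} → L ⊆ M → L′ ⊆ M → L ++ L′ ⊆ M
  ++⊆ {L} L⊆M L′⊆M e∈ with ∈-++⁻ eqnSetoid L e∈
  ... | inj₁ e∈L  = L⊆M e∈L
  ... | inj₂ e∈L′ = L′⊆M e∈L′

  ∷-cong : ∀ {e e′ L} → _≈E_ R e e′ → (e ∷ L) ≈ᶜ (e′ ∷ L)
  ∷-cong e≈e′ = ⊆-antisym (∷⊆ (here e≈e′) ⊆∷) (∷⊆ (here (≈ₑ-sym e≈e′)) ⊆∷)

  ∷-congʳ : ∀ {e L M} → L ≈ᶜ M → (e ∷ L) ≈ᶜ (e ∷ M)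
  ∷-congʳ L≈M =
    ⊆-antisym (∷⊆ ∈-head (⊆-trans (≈ᶜ⇒⊆ L≈M) ⊆∷)) (∷⊆ ∈-head (⊆-trans (≈ᶜ⇒⊇ L≈M) ⊆∷))

  absorb : ∀ L M → (L ++ (L ++ M)) ≈ᶜ (L ++ M)
  absorb L M = ⊆-antisym (++⊆ (⊆++ˡ M) ⊆-refl) (⊆++ʳ L)

  ++-idem : ∀ {L} → L ≈ᶜ (L ++ L)
  ++-idem {L} = ⊆-antisym (⊆++ˡ L) (++⊆ ⊆-refl ⊆-refl)

  ≐-cong : ∀ v {A B} → A ≈ B → _≈E_ R (v ≐ A) (v ≐ B)
  ≐-cong v A≈B = (λ _ → refl) , -‿cong A≈B

  ∈-≐⁺ : ∀ v {A U} → A ∈ᵥ U → (v ≐ A) ∈ₑ map (v ≐_) U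
  ∈-≐⁺ v = ∈-map⁺ setoid eqnSetoid (≐-cong v)

  ≐⊆ : ∀ v {U M} → (∀ {A} → A ∈ᵥ U → (v ≐ A) ∈ₑ M) → map (v ≐_) U ⊆ M
  ≐⊆ v eq∈M e∈ with ∈-map⁻ setoid eqnSetoid e∈
  ... | A , A∈U , e≈ = ∈-resp-≈ eqnSetoid (≈ₑ-sym e≈) (eq∈M A∈U)

  ≐-mono : ∀ v {U U′} → U ⊆ᵥ U′ → map (v ≐_) U ⊆ map (v ≐_) U′
  ≐-mono v U⊆U′ = ≐⊆ v (λ A∈U → ∈-≐⁺ v (U⊆U′ A∈U))

  eqnSizeBound : ℕ
  eqnSizeBound = n +ℕ (n +ℕ 1)

  countNZ≤ : ∀ {m} (v : Fin m → Carrier) → countNZ R v ≤ m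
  countNZ≤ {zero}  v = z≤n
  countNZ≤ {suc m} v with does (v Fin.zero ≟ 0#)
  ... | true  = m≤n⇒m≤1+n (countNZ≤ (λ i → v (Fin.suc i)))
  ... | false = s≤s (countNZ≤ (λ i → v (Fin.suc i)))

  eqSize≤ : ∀ (e : Eq) → eqSize R e ≤ eqnSizeBound
  eqSize≤ e = +-mono-≤ (countNZ≤ (coeffs e)) (+-monoˡ-≤ 1 (countNZ≤ (coeffs e)))

  clauseSize≤ : ∀ (L : Cl) → clauseSize R L ≤ length L *ℕ eqnSizeBound
  clauseSize≤ []      = z≤n
  clauseSize≤ (e ∷ L) = +-mono-≤ (eqSize≤ e) (clauseSize≤ L)

  clauseSize-pos : ∀ (L : Cl) → 1 ≤ length L → 1 ≤ clauseSize R L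
  clauseSize-pos (e ∷ L) _ =
    ≤-trans (m≤n+m 1 k) (≤-trans (m≤n+m (k +ℕ 1) k) (m≤m+n (eqSize R e) (clauseSize R L)))
    where k = countNZ R (coeffs e)

  retarget : ∀ {E F} → TreeDeriv R E → E ≈ᶜ F → TreeDeriv R F
  retarget (axiom i E≈)                      E≈F = axiom i (≈ᶜ-trans (≈ᶜ-sym E≈F) E≈)
  retarget (res C D f g α β P≈ Q≈ E≈ π ρ)   E≈F =
    res C D f g α β P≈ Q≈ (≈ᶜ-trans (≈ᶜ-sym E≈F) E≈) π ρ
  retarget (simp C a a≉0 P≈ E≈ π)           E≈F = simp C a a≉0 P≈ (≈ᶜ-trans (≈ᶜ-sym E≈F) E≈) π
  retarget (weak g E≈ π)                     E≈F = weak g (≈ᶜ-trans (≈ᶜ-sym E≈F) E≈) π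

  retarget-size : ∀ {E F} (π : TreeDeriv R E) (E≈F : E ≈ᶜ F) →
                  derivSize R (retarget π E≈F) ≤ clauseSize R F +ℕ derivSize R π
  retarget-size (axiom i _)                         E≈F = m≤m+n _ _
  retarget-size {E} {F} (res _ _ _ _ _ _ _ _ _ π ρ) E≈F =
    +-monoʳ-≤ (clauseSize R F) (m≤n+m (derivSize R π +ℕ derivSize R ρ) (clauseSize R E))
  retarget-size {E} {F} (simp _ _ _ _ _ π)          E≈F =
    +-monoʳ-≤ (clauseSize R F) (m≤n+m (derivSize R π) (clauseSize R E))
  retarget-size {E} {F} (weak _ _ π)                E≈F =
    +-monoʳ-≤ (clauseSize R F) (m≤n+m (derivSize R π) (clauseSize R E))

  -- If every clause has at most `width` literals it has
  -- size at most clauseBound, so a derivation with at most N nodes has size at most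
  -- N · clauseBound; Deriv E N packages a derivation of E with that size bound.
  module NodeCount (width : ℕ) where

    clauseBound : ℕ
    clauseBound = width *ℕ eqnSizeBound

    fits : ∀ (E : Cl) → length E ≤ width → clauseSize R E ≤ clauseBound
    fits E w = ≤-trans (clauseSize≤ E) (*-monoˡ-≤ eqnSizeBound w)

    record Deriv (E : Cl) (N : ℕ) : Set (c ⊔ˡ ℓ) where
      constructor _,_
      field
        tree    : TreeDeriv R E
        bounded : derivSize R tree ≤ N *ℕ clauseBound

    raise : ∀ {E N M} → N ≤ M → Deriv E N → Deriv E M
    raise N≤M (π , size≤) = π , ≤-trans size≤ (*-monoˡ-≤ clauseBound N≤M)

    byAxiom : ∀ i → 2 ≤ width → Deriv (boolAx R i) 1
    byAxiom i w =
      axiom i ≈ᶜ-refl , ≤-trans (fits (boolAx R i) w) (≤-reflexive (≡.sym (ℕₚ.+-identityʳ clauseBound)))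

    byResolution : ∀ {P Q E NP NQ} (C D : Cl) (f g : Eq) (α β : Carrier) →
                   P ≈ᶜ (f ∷ C) → Q ≈ᶜ (g ∷ D) → E ≈ᶜ (lincomb R α f β g ∷ (C ++ D)) →
                   length E ≤ width → Deriv P NP → Deriv Q NQ → Deriv E (suc (NP +ℕ NQ))
    byResolution {E = E} {NP} {NQ} C D f g α β P≈ Q≈ E≈ w (π , sπ) (ρ , sρ) =
      res C D f g α β P≈ Q≈ E≈ π ρ ,
      ≤-trans (+-mono-≤ (fits E w) (+-mono-≤ sπ sρ))
              (≤-reflexive (≡.cong (clauseBound +ℕ_) (≡.sym (ℕₚ.*-distribʳ-+ clauseBound NP NQ))))

    bySimplification : ∀ {P E N} (C : Cl) (a : Carrier) → ¬ (a ≈ 0#) →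
                       P ≈ᶜ (constEqn R a ∷ C) → E ≈ᶜ C → length E ≤ width → Deriv P N → Deriv E (suc N)
    bySimplification {E = E} C a a≉0 P≈ E≈ w (π , sπ) = simp C a a≉0 P≈ E≈ π , +-mono-≤ (fits E w) sπ

    relabel : ∀ {E F N} → E ≈ᶜ F → length F ≤ width → Deriv E N → Deriv F (suc N)
    relabel {F = F} E≈F w (π , sπ) = retarget π E≈F , ≤-trans (retarget-size π E≈F) (+-mono-≤ (fits F w) sπ)

    sumRule : ∀ {g h gh : Form} {A B : Carrier} {P Q E : Cl} {NP NQ Γ₁ Γ₂} →
              (∀ i → 1# * g i + 1# * h i ≈ gh i) →
              P ≈ᶜ ((g ≐ A) ∷ Γ₁) → Q ≈ᶜ ((h ≐ B) ∷ Γ₂) → E ≈ᶜ ((gh ≐ (A + B)) ∷ (Γ₁ ++ Γ₂)) →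
              length E ≤ width → Deriv P NP → Deriv Q NQ → Deriv E (suc (NP +ℕ NQ))
    sumRule {A = A} {B} {Γ₁ = Γ₁} {Γ₂} g+h P≈ Q≈ E≈ =
      byResolution Γ₁ Γ₂ _ _ 1# 1# P≈ Q≈ (≈ᶜ-trans E≈ (∷-cong (≈ₑ-sym (g+h , constants))))
      where
      constants : 1# * (- A) + 1# * (- B) ≈ - (A + B)
      constants = trans (+-cong (*-identityˡ (- A)) (*-identityˡ (- B))) (-‿+-comm A B)

    -- Subtracting gives the constant equation −a + b = 0, which
    -- simplification removes.
    cutRule : ∀ {g : Form} {a b : Carrier} {P Q E : Cl} {NP NQ Γ₁ Γ₂} → ¬ (a ≈ b) →
              P ≈ᶜ ((g ≐ a) ∷ Γ₁) → Q ≈ᶜ ((g ≐ b) ∷ Γ₂) → E ≈ᶜ (Γ₁ ++ Γ₂) →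
              suc (length E) ≤ width → Deriv P NP → Deriv Q NQ → Deriv E (suc (suc (NP +ℕ NQ)))
    cutRule {g = g} {a} {b} {E = E} {Γ₁ = Γ₁} {Γ₂} a≉b P≈ Q≈ E≈ w πP πQ =
      bySimplification E k k≉0 ≈ᶜ-refl ≈ᶜ-refl (≤-trans (n≤1+n (length E)) w)
        (byResolution Γ₁ Γ₂ _ _ 1# (- 1#) P≈ Q≈ (≈ᶜ-trans (∷-congʳ E≈) (∷-cong difference)) w πP πQ)
      where
      k : Carrier
      k = 1# * (- a) + (- 1#) * (- b)
      difference : _≈E_ R (constEqn R k) (lincomb R 1# (g ≐ a) (- 1#) (g ≐ b))
      difference = (λ i → sym (trans (+-cong (*-identityˡ (g i)) (-1*x≈-x (g i))) (-‿inverseʳ (g i)))) , refl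
      k≉0 : ¬ (k ≈ 0#)
      k≉0 k≈0 = a≉b (sym (trans (+-inverseʳ-unique (- a) b −a+b≈0) (-‿involutive a)))
        where
        −a+b≈0 : (- a) + b ≈ 0#
        −a+b≈0 = trans (+-cong (sym (*-identityˡ (- a))) (trans (sym (-‿involutive b)) (sym (-1*x≈-x (- b))))) k≈0

    -- Scaling one equation: from  e ∨ Γ  derive  αe ∨ Γ, resolving the clause with a copy
    -- of itself whose equation is multiplied by 0.
    scaleRule : ∀ {e : Eq} {P E : Cl} {N Γ} (α : Carrier) →
                P ≈ᶜ (e ∷ Γ) → E ≈ᶜ (lincomb R α e 0# e ∷ Γ) → length E ≤ width →
                Deriv P N → Deriv E (suc (N +ℕ N))
    scaleRule {e} {Γ = Γ} α P≈ E≈ w π =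
      byResolution Γ Γ e e α 0# P≈ P≈ (≈ᶜ-trans E≈ (∷-congʳ ++-idem)) w π π

-- From derivations of  Im_S(g) = ⋁_{A∈S} g = A  and  Im_T(h) = ⋁_{B∈T} h = B  derive
-- ⋁_{A∈S, B∈T} gh = A + B.  For a single a ∈ S, a chain of |T| sum-resolutions of
-- Im_S(g) against Im_T(h) replaces  g = a  by the row  ⋁_{B∈T} gh = a + B, carrying
-- the other g-equations along.  The chains for the values of S are then merged by
-- cuts on pairs of distinct g-values, in a tree with 2^{|S|−1} chains as leaves.
module Combination {c ℓ : Level} (R : FiniteRing c ℓ) (n width : ℕ) where
  open import Data.Nat using (suc; _≤_; s≤s) renaming (_+_ to _+ℕ_; _*_ to _*ℕ_)
  open import Data.Nat.Properties
    using (≤-trans; ≤-reflexive; ≤-refl; +-mono-≤; +-monoˡ-≤; +-monoʳ-≤; *-monoˡ-≤; m≤m+n; n≤1+n)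
  import Data.Nat.Properties as ℕₚ
  open import Data.Nat.Tactic.RingSolver using (solve-∀)
  open import Data.List using (List; []; _∷_; _++_; map; length; filter; cartesianProductWith)
  open import Data.List.Properties using (length-++; length-map; length-filter; ++-assoc; ++-identityʳ)
  open import Data.List.Relation.Unary.Any using (here; there; any?)
  open import Data.Product using (∃; _×_; _,_)
  open import Function using (_$_)
  open import Data.Sum using (inj₁; inj₂)
  open import Relation.Nullary using (¬_; Dec; yes; no; ¬?; contradiction)
  open import Relation.Binary.PropositionalEquality as ≡ using (_≡_)
  import Data.List.Membership.Setoid.Properties as MembershipProperties
  open Arithmetic using (mergeCost)
  open FiniteRing R hiding (zero)
  open ClauseCalculus R n
  open NodeCount width
  open MembershipProperties using (∈-resp-≈; ∉-resp-≈; ∈-++⁻; ∈-++⁺ˡ; ∈-++⁺ʳ; ∈-map⁻;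
    ∈-filter⁺; ∈-filter⁻; ∈-cartesianProductWith⁺; ∈-cartesianProductWith⁻)

  _⊕_ : List Carrier → List Carrier → List Carrier
  U ⊕ U′ = cartesianProductWith _+_ U U′

  length-⊕ : ∀ U U′ → length (U ⊕ U′) ≡ length U *ℕ length U′
  length-⊕ []      U′ = ≡.refl
  length-⊕ (A ∷ U) U′ = ≡.trans (length-++ (map (A +_) U′))
                          (≡.cong₂ _+ℕ_ (length-map (A +_) U′) (length-⊕ U U′))

  ∈-⊕⁺ : ∀ {A B U U′} → A ∈ᵥ U → B ∈ᵥ U′ → (A + B) ∈ᵥ (U ⊕ U′)
  ∈-⊕⁺ = ∈-cartesianProductWith⁺ setoid setoid setoid +-cong

  ∈-⊕⁻ : ∀ {C} U U′ → C ∈ᵥ (U ⊕ U′) →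
         ∃ λ A → ∃ λ B → A ∈ᵥ U × B ∈ᵥ U′ × C ≈ A + B
  ∈-⊕⁻ U U′ = ∈-cartesianProductWith⁻ setoid setoid setoid _+_ U U′

  module _ {g h gh : Form} (g+h : ∀ i → 1# * g i + 1# * h i ≈ gh i)
           (s₀ : Carrier) (S′ : List Carrier) (t₀ : Carrier) (T′ : List Carrier)
           (wide : suc (length (s₀ ∷ S′) +ℕ length (s₀ ∷ S′) *ℕ length (t₀ ∷ T′)) ≤ width)
           {N : ℕ} (πX : Deriv (map (g ≐_) (s₀ ∷ S′)) N) (πY : Deriv (map (h ≐_) (t₀ ∷ T′)) N) where

    S T : List Carrier
    S = s₀ ∷ S′
    T = t₀ ∷ T′

    rows : List Carrier → List Carrier → Cl
    rows W Bs = map (gh ≐_) (W ⊕ Bs)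

    ∈-rows : ∀ {A B} W Bs → A ∈ᵥ W → B ∈ᵥ Bs → (gh ≐ (A + B)) ∈ₑ rows W Bs
    ∈-rows W Bs A∈W B∈Bs = ∈-≐⁺ gh (∈-⊕⁺ A∈W B∈Bs)

    rows⊆ : ∀ {W Bs M} → (∀ {A B} → A ∈ᵥ W → B ∈ᵥ Bs → (gh ≐ (A + B)) ∈ₑ M) → rows W Bs ⊆ M
    rows⊆ {W} {Bs} row∈M e∈ with ∈-map⁻ setoid eqnSetoid e∈
    ... | C , C∈ , e≈ with ∈-cartesianProductWith⁻ setoid setoid setoid _+_ W Bs C∈
    ...   | A , B , A∈W , B∈Bs , C≈ =
      ∈-resp-≈ eqnSetoid (≈ₑ-sym (≈ₑ-trans e≈ (≐-cong gh C≈))) (row∈M A∈W B∈Bs)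

    rows-mono : ∀ W W′ Bs Bs′ → W ⊆ᵥ W′ → Bs ⊆ᵥ Bs′ → rows W Bs ⊆ rows W′ Bs′
    rows-mono W W′ Bs Bs′ W⊆ Bs⊆ = rows⊆ (λ A∈W B∈Bs → ∈-rows W′ Bs′ (W⊆ A∈W) (Bs⊆ B∈Bs))

    _∉?_ : ∀ A W → Dec (A ∉ᵥ W)
    A ∉? W = ¬? (any? (A ≟_) W)

    outside : List Carrier → List Carrier
    outside W = filter (_∉? W) S

    rest : List Carrier → Cl
    rest W = map (g ≐_) (outside W)

    ∈-rest : ∀ {A} W → A ∈ᵥ S → A ∉ᵥ W → (g ≐ A) ∈ₑ rest W
    ∈-rest W A∈S A∉W =
      ∈-≐⁺ g (∈-filter⁺ setoid (_∉? W) (∉-resp-≈ setoid) A∈S A∉W)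

    rest⊆ : ∀ W {M} → (∀ {A} → A ∈ᵥ S → A ∉ᵥ W → (g ≐ A) ∈ₑ M) → rest W ⊆ M
    rest⊆ W eq∈M e∈ with ∈-map⁻ setoid eqnSetoid e∈
    ... | A , A∈ , e≈ with ∈-filter⁻ setoid (_∉? W) (∉-resp-≈ setoid) A∈
    ...   | A∈S , A∉W = ∈-resp-≈ eqnSetoid (≈ₑ-sym e≈) (eq∈M A∈S A∉W)

    rest-anti : ∀ {W W′} → W′ ⊆ᵥ W → rest W ⊆ rest W′
    rest-anti {W} {W′} W′⊆W =
      rest⊆ W (λ A∈S A∉W → ∈-rest W′ A∈S (λ A∈W′ → A∉W (W′⊆W A∈W′)))

    -- The intermediate clauses: the chains for the values in W have been merged.
    Ψ : List Carrier → Cl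
    Ψ W = rest W ++ rows W T

    Ψ-cong : ∀ {W W′} → W ⊆ᵥ W′ → W′ ⊆ᵥ W → Ψ W ≈ᶜ Ψ W′
    Ψ-cong W⊆W′ W′⊆W = ⊆-antisym (bound W′⊆W W⊆W′) (bound W⊆W′ W′⊆W)
      where
      bound : ∀ {V V′} → V′ ⊆ᵥ V → V ⊆ᵥ V′ → Ψ V ⊆ Ψ V′
      bound {V} {V′} V′⊆V V⊆V′ =
        ++⊆ (⊆-trans (rest-anti V′⊆V) (⊆++ˡ (rows V′ T)))
            (⊆-trans (rows-mono V V′ T T V⊆V′ (λ B∈ → B∈)) (⊆++ʳ (rest V′)))

    Ψ-extract : ∀ {x W} → x ∈ᵥ S → x ∉ᵥ W → Ψ W ≈ᶜ ((g ≐ x) ∷ (rest (x ∷ W) ++ rows W T))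
    Ψ-extract {x} {W} x∈S x∉W = ⊆-antisym
      (++⊆ (rest⊆ W front) (⊆-trans (⊆++ʳ (rest (x ∷ W))) ⊆∷))
      (∷⊆ (⊆++ˡ (rows W T) (∈-rest W x∈S x∉W))
          (++⊆ (⊆-trans (rest-anti {x ∷ W} {W} there) (⊆++ˡ (rows W T))) (⊆++ʳ (rest W))))
      where
      front : ∀ {A} → A ∈ᵥ S → A ∉ᵥ W → (g ≐ A) ∈ₑ ((g ≐ x) ∷ (rest (x ∷ W) ++ rows W T))
      front {A} A∈S A∉W with A ≟ x
      ... | yes A≈x = here (≐-cong g A≈x)
      ... | no  A≉x =
        there (⊆++ˡ (rows W T) (∈-rest (x ∷ W) A∈S λ { (here A≈x) → A≉x A≈x ; (there A∈W) → A∉W A∈W }))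

    Ψ-length : ∀ W → length W ≤ length S → length (Ψ W) ≤ length S +ℕ length S *ℕ length T
    Ψ-length W W≤S = begin
      length (Ψ W)                           ≡⟨ length-++ (rest W) ⟩
      length (rest W) +ℕ length (rows W T)   ≡⟨ ≡.cong₂ _+ℕ_ (length-map (g ≐_) (outside W))
                                                  (≡.trans (length-map (gh ≐_) (W ⊕ T)) (length-⊕ W T)) ⟩
      length (outside W) +ℕ length W *ℕ length T
          ≤⟨ +-mono-≤ (length-filter (_∉? W) S) (*-monoˡ-≤ (length T) W≤S) ⟩
      length S +ℕ length S *ℕ length T       ∎
      where open ℕₚ.≤-Reasoning

    S+T≤width : length S +ℕ length T ≤ width
    S+T≤width =
      ≤-trans (+-monoʳ-≤ (length S) (m≤m+n (length T) (length S′ *ℕ length T))) (≤-trans (n≤1+n _) wide)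

    -- Its state after handling the values
    -- Done of T, with Rest still to do, is  ⋁_{B∈Rest} h = B ∨ Δ ∨ ⋁_{B∈Done} gh = a + B,
    -- where Δ = rest [a] are the other g-equations of Im_S(g).
    module Chain {a : Carrier} (a∈S : a ∈ᵥ S) where

      Δ : Cl
      Δ = rest (a ∷ [])

      state : List Carrier → List Carrier → Cl
      state Rest Done = map (h ≐_) Rest ++ (Δ ++ rows (a ∷ []) Done)

      X≈ : map (g ≐_) S ≈ᶜ ((g ≐ a) ∷ Δ)
      X≈ = ⊆-antisym (≐⊆ g split) (∷⊆ (∈-≐⁺ g a∈S) (rest⊆ (a ∷ []) λ A∈S _ → ∈-≐⁺ g A∈S))
        where
        split : ∀ {A} → A ∈ᵥ S → (g ≐ A) ∈ₑ ((g ≐ a) ∷ Δ)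
        split {A} A∈S with A ≟ a
        ... | yes A≈a = here (≐-cong g A≈a)
        ... | no  A≉a = there (∈-rest (a ∷ []) A∈S λ { (here A≈a) → A≉a A≈a })

      state-length : ∀ Rest Done → Done ++ Rest ≡ T → length (state Rest Done) ≤ width
      state-length Rest Done eq = begin
        length (state Rest Done)
          ≡⟨ length-++ (map (h ≐_) Rest) ⟩
        length (map (h ≐_) Rest) +ℕ length (Δ ++ rows (a ∷ []) Done)
          ≡⟨ ≡.cong₂ _+ℕ_ (length-map (h ≐_) Rest)
               (≡.trans (length-++ Δ) (≡.cong₂ _+ℕ_ (length-map (g ≐_) (outside (a ∷ [])))
                 (≡.trans (length-map (gh ≐_) ((a ∷ []) ⊕ Done)) (length-⊕ (a ∷ []) Done)))) ⟩
        length Rest +ℕ (length (outside (a ∷ [])) +ℕ 1 *ℕ length Done)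
          ≤⟨ +-monoʳ-≤ (length Rest) (+-monoˡ-≤ (1 *ℕ length Done) (length-filter (_∉? (a ∷ [])) S)) ⟩
        length Rest +ℕ (length S +ℕ 1 *ℕ length Done)
          ≡⟨ regroup (length Rest) (length S) (length Done) ⟩
        length S +ℕ (length Done +ℕ length Rest)
          ≡⟨ ≡.cong (length S +ℕ_) (≡.trans (≡.sym (length-++ Done)) (≡.cong length eq)) ⟩
        length S +ℕ length T
          ≤⟨ S+T≤width ⟩
        width ∎
        where
        open ℕₚ.≤-Reasoning
        regroup : ∀ r s d → r +ℕ (s +ℕ 1 *ℕ d) ≡ s +ℕ (d +ℕ r)
        regroup = solve-∀

      step-clause : ∀ B Rest Done {Γ} → (Δ ++ Γ) ≈ᶜ (Δ ++ rows (a ∷ []) Done) →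
                    state Rest (Done ++ B ∷ []) ≈ᶜ ((gh ≐ (a + B)) ∷ (Δ ++ (map (h ≐_) Rest ++ Γ)))
      step-clause B Rest Done {Γ} Γ≈ = ⊆-antisym new⊆ old⊆
        where
        Hs Rd Rd′ Old New : Cl
        Hs  = map (h ≐_) Rest
        Rd  = rows (a ∷ []) Done
        Rd′ = rows (a ∷ []) (Done ++ B ∷ [])
        Old = (gh ≐ (a + B)) ∷ (Δ ++ (Hs ++ Γ))
        New = Hs ++ (Δ ++ Rd′)
        Hs⊆Old : Hs ⊆ Old
        Hs⊆Old = ⊆-trans (⊆++ˡ Γ) (⊆-trans (⊆++ʳ Δ) ⊆∷)
        Δ⊆Old : Δ ⊆ Old
        Δ⊆Old = ⊆-trans (⊆++ˡ (Hs ++ Γ)) ⊆∷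
        Γ⊆Old : Γ ⊆ Old
        Γ⊆Old = ⊆-trans (⊆++ʳ Hs) (⊆-trans (⊆++ʳ Δ) ⊆∷)
        Rd⊆Old : Rd ⊆ Old
        Rd⊆Old = ⊆-trans (⊆++ʳ Δ) (⊆-trans (≈ᶜ⇒⊇ Γ≈) (++⊆ Δ⊆Old Γ⊆Old))
        Rd′⊆Old : Rd′ ⊆ Old
        Rd′⊆Old = rows⊆ row∈
          where
          row∈ : ∀ {A B′} → A ∈ᵥ (a ∷ []) → B′ ∈ᵥ (Done ++ B ∷ []) → (gh ≐ (A + B′)) ∈ₑ Old
          row∈ A∈ B′∈ with ∈-++⁻ setoid Done B′∈
          ... | inj₁ B′∈Done = Rd⊆Old (∈-rows (a ∷ []) Done A∈ B′∈Done)
          row∈ (here A≈a) _ | inj₂ (here B′≈B) = here (≐-cong gh (+-cong A≈a B′≈B))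
        Hs⊆New : Hs ⊆ New
        Hs⊆New = ⊆++ˡ (Δ ++ Rd′)
        Δ⊆New : Δ ⊆ New
        Δ⊆New = ⊆-trans (⊆++ˡ Rd′) (⊆++ʳ Hs)
        Rd′⊆New : Rd′ ⊆ New
        Rd′⊆New = ⊆-trans (⊆++ʳ Δ) (⊆++ʳ Hs)
        Rd⊆New : Rd ⊆ New
        Rd⊆New = ⊆-trans (rows-mono (a ∷ []) (a ∷ []) Done (Done ++ B ∷ []) (λ p → p) (∈-++⁺ˡ setoid))
                         Rd′⊆New
        Γ⊆New : Γ ⊆ New
        Γ⊆New = ⊆-trans (⊆++ʳ Δ) (⊆-trans (≈ᶜ⇒⊆ Γ≈) (++⊆ Δ⊆New Rd⊆New))
        new⊆ : New ⊆ Old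
        new⊆ = ++⊆ Hs⊆Old (++⊆ Δ⊆Old Rd′⊆Old)
        old⊆ : Old ⊆ New
        old⊆ = ∷⊆ (Rd′⊆New (∈-rows (a ∷ []) (Done ++ B ∷ []) (here refl) (∈-++⁺ʳ setoid Done (here refl))))
                  (++⊆ Δ⊆New (++⊆ Hs⊆New Γ⊆New))

      step : ∀ B Rest Done {Γ Q NQ} → Done ++ B ∷ Rest ≡ T → (Δ ++ Γ) ≈ᶜ (Δ ++ rows (a ∷ []) Done) →
             Q ≈ᶜ ((h ≐ B) ∷ (map (h ≐_) Rest ++ Γ)) → Deriv Q NQ →
             Deriv (state Rest (Done ++ B ∷ [])) (suc (N +ℕ NQ))
      step B Rest Done eq Γ≈ Q≈ πQ =
        sumRule g+h X≈ Q≈ (step-clause B Rest Done Γ≈)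
          (state-length Rest (Done ++ B ∷ []) (≡.trans (++-assoc Done (B ∷ []) Rest) eq)) πX πQ

      sweep : ∀ Rest Done {M} → Done ++ Rest ≡ T → Deriv (state Rest Done) M →
              Deriv (Ψ (a ∷ [])) (M +ℕ length Rest *ℕ suc N)
      sweep []         Done {M} eq π =
        raise (m≤m+n M 0)
          (≡.subst (λ D → Deriv (Δ ++ rows (a ∷ []) D) M) (≡.trans (≡.sym (++-identityʳ Done)) eq) π)
      sweep (B ∷ Rest) Done {M} eq π =
        raise (≤-reflexive (regroup N M (length Rest)))
          (sweep Rest (Done ++ B ∷ []) (≡.trans (++-assoc Done (B ∷ []) Rest) eq)
            (step B Rest Done eq (absorb Δ (rows (a ∷ []) Done)) ≈ᶜ-refl π))
        where
        regroup : ∀ N M r → suc (N +ℕ M) +ℕ r *ℕ suc N ≡ M +ℕ (suc N +ℕ r *ℕ suc N)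
        regroup = solve-∀

      chain : Deriv (Ψ (a ∷ [])) (suc (length T) *ℕ suc N)
      chain = raise (≤-trans (n≤1+n _) (≤-reflexive (count N (length T′))))
                (sweep T′ (t₀ ∷ []) ≡.refl (step t₀ T′ [] ≡.refl ≈ᶜ-refl Y≈ πY))
        where
        Y≈ : map (h ≐_) T ≈ᶜ ((h ≐ t₀) ∷ (map (h ≐_) T′ ++ []))
        Y≈ = ∷-congʳ (⊆-antisym (⊆++ˡ []) (++⊆ ⊆-refl []⊆))
        count : ∀ N t → suc (suc (N +ℕ N) +ℕ t *ℕ suc N) ≡ suc (suc t) *ℕ suc N
        count = solve-∀

    chainCost : ℕ
    chainCost = suc (length T) *ℕ suc N

    Ψ-fits : ∀ W → length W ≤ length S → suc (length (Ψ W)) ≤ width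
    Ψ-fits W W≤S = ≤-trans (s≤s (Ψ-length W W≤S)) wide

    relabel≤merge : ∀ m → suc m ≤ 2 +ℕ (m +ℕ m)
    relabel≤merge m = ≤-trans (n≤1+n (suc m)) (s≤s (s≤s (m≤m+n m m)))

    -- A repeated
    -- value is dropped by relabelling; for distinct a, b the clauses Ψ (b ∷ U′) and
    -- Ψ (a ∷ U′) contain g = a and g = b respectively, and a cut merges them.
    merged : ∀ a U → a ∈ᵥ S → U ⊆ᵥ S → length (a ∷ U) ≤ length S →
             Deriv (Ψ (a ∷ U)) (mergeCost chainCost (length U))
    merged a []       a∈S _   _   = Chain.chain a∈S
    merged a (b ∷ U′) a∈S U⊆S len with any? (a ≟_) (b ∷ U′) | any? (b ≟_) U′
    ... | yes a∈bU′ | _ =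
      raise (relabel≤merge _) $ relabel (Ψ-cong there drop-a) (≤-trans (n≤1+n _) (Ψ-fits W len))
        (merged b U′ (U⊆S (here refl)) (λ p → U⊆S (there p)) (≤-trans (n≤1+n _) len))
      where
      W = a ∷ b ∷ U′
      drop-a : W ⊆ᵥ (b ∷ U′)
      drop-a (here A≈a) = ∈-resp-≈ setoid (sym A≈a) a∈bU′
      drop-a (there p)  = p
    ... | no a∉bU′ | yes b∈U′ =
      raise (relabel≤merge _) $ relabel (Ψ-cong add-b drop-b) (≤-trans (n≤1+n _) (Ψ-fits W len))
        (merged a U′ a∈S (λ p → U⊆S (there p)) (≤-trans (n≤1+n _) len))
      where
      W = a ∷ b ∷ U′
      add-b : (a ∷ U′) ⊆ᵥ W
      add-b (here A≈a) = here A≈a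
      add-b (there p)  = there (there p)
      drop-b : W ⊆ᵥ (a ∷ U′)
      drop-b (here A≈a)         = here A≈a
      drop-b (there (here A≈b)) = there (∈-resp-≈ setoid (sym A≈b) b∈U′)
      drop-b (there (there p))  = there p
    ... | no a∉bU′ | no b∉U′ =
      cutRule a≉b (Ψ-extract a∈S a∉bU′) (Ψ-extract (U⊆S (here refl)) b∉aU′) split (Ψ-fits W len)
        (merged b U′ (U⊆S (here refl)) (λ p → U⊆S (there p)) (≤-trans (n≤1+n _) len))
        (merged a U′ a∈S (λ p → U⊆S (there p)) (≤-trans (n≤1+n _) len))
      where
      W = a ∷ b ∷ U′
      a≉b : ¬ (a ≈ b)
      a≉b a≈b = a∉bU′ (here a≈b)
      b∉aU′ : b ∉ᵥ (a ∷ U′)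
      b∉aU′ (here b≈a)  = a∉bU′ (here (sym b≈a))
      b∉aU′ (there b∈U′) = b∉U′ b∈U′
      Γ₁ Γ₂ : Cl
      Γ₁ = rest W ++ rows (b ∷ U′) T
      Γ₂ = rest (b ∷ a ∷ U′) ++ rows (a ∷ U′) T
      row∈ : ∀ {A B} → A ∈ᵥ W → B ∈ᵥ T → (gh ≐ (A + B)) ∈ₑ (Γ₁ ++ Γ₂)
      row∈ (here A≈a) B∈T =
        ⊆++ʳ Γ₁ (⊆++ʳ (rest (b ∷ a ∷ U′)) (∈-rows (a ∷ U′) T (here A≈a) B∈T))
      row∈ (there p)  B∈T = ⊆++ˡ Γ₂ (⊆++ʳ (rest W) (∈-rows (b ∷ U′) T p B∈T))
      swap : W ⊆ᵥ (b ∷ a ∷ U′)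
      swap (here A≈a)         = there (here A≈a)
      swap (there (here A≈b)) = here A≈b
      swap (there (there p))  = there (there p)
      add-a : (a ∷ U′) ⊆ᵥ W
      add-a (here A≈a) = here A≈a
      add-a (there p)  = there (there p)
      split : Ψ W ≈ᶜ (Γ₁ ++ Γ₂)
      split = ⊆-antisym
        (++⊆ (⊆-trans (⊆++ˡ (rows (b ∷ U′) T)) (⊆++ˡ Γ₂)) (rows⊆ row∈))
        (++⊆ (++⊆ (⊆++ˡ (rows W T))
                  (⊆-trans (rows-mono (b ∷ U′) W T T there (λ p → p)) (⊆++ʳ (rest W))))
             (++⊆ (⊆-trans (rest-anti swap) (⊆++ˡ (rows W T)))
                  (⊆-trans (rows-mono (a ∷ U′) W T T add-a (λ p → p)) (⊆++ʳ (rest W)))))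

    combine : ∀ {E} → E ≈ᶜ rows S T → length E ≤ width → Deriv E (suc (mergeCost chainCost (length S′)))
    combine E≈ w = relabel (≈ᶜ-trans ΨS≈ (≈ᶜ-sym E≈)) w (merged s₀ S′ (here refl) there ≤-refl)
      where
      ΨS≈ : Ψ S ≈ᶜ rows S T
      ΨS≈ = ⊆-antisym (++⊆ (rest⊆ S (λ A∈S A∉S → contradiction A∈S A∉S)) ⊆-refl) (⊆++ʳ (rest S))

module Evaluation {c ℓ : Level} (R : FiniteRing c ℓ) (n : ℕ) where
  open import Data.Nat using (zero; suc)
  open import Data.Bool using (Bool; true; false)
  open import Data.List.Relation.Unary.Any as Any using (Any; here; there; any?)
  import Data.List.Relation.Unary.Any.Properties as Anyₚ
  open import Data.Sum using (_⊎_; inj₁; inj₂)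
  open import Relation.Nullary using (Dec)
  open import Relation.Binary.PropositionalEquality as ≡ using (_≡_; _≢_)
  open import Data.Fin.Properties using (suc-injective)
  import Algebra.Properties.CommutativeSemigroup as CommutativeSemigroupProperties
  open FiniteRing R hiding (zero)
  open ClauseCalculus R n using (Form)
  open CommutativeSemigroupProperties +-commutativeSemigroup using (interchange)

  sumF-cong : ∀ {m} {u v : Fin m → Carrier} → (∀ i → u i ≈ v i) → sumF R u ≈ sumF R v
  sumF-cong {zero}  u≈v = refl
  sumF-cong {suc m} u≈v = +-cong (u≈v Fin.zero) (sumF-cong (λ i → u≈v (Fin.suc i)))

  sumF-+ : ∀ {m} (u v : Fin m → Carrier) → sumF R (λ i → u i + v i) ≈ sumF R u + sumF R v
  sumF-+ {zero}  u v = sym (+-identityˡ 0#)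
  sumF-+ {suc m} u v = trans (+-cong refl (sumF-+ (λ i → u (Fin.suc i)) (λ i → v (Fin.suc i)))) (interchange _ _ _ _)

  sumF-zero : ∀ {m} (u : Fin m → Carrier) → (∀ i → u i ≈ 0#) → sumF R u ≈ 0#
  sumF-zero {zero}  u u≈0 = refl
  sumF-zero {suc m} u u≈0 = trans (+-cong (u≈0 Fin.zero) (sumF-zero _ (λ i → u≈0 (Fin.suc i)))) (+-identityˡ 0#)

  sumF-single : ∀ {m} (j : Fin m) (u : Fin m → Carrier) → (∀ i → i ≢ j → u i ≈ 0#) → sumF R u ≈ u j
  sumF-single Fin.zero    u u≈0 = trans (+-cong refl (sumF-zero _ (λ i → u≈0 (Fin.suc i) (λ ())))) (+-identityʳ _)
  sumF-single (Fin.suc j) u u≈0 =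
    trans (+-cong (u≈0 Fin.zero (λ ()))
                  (sumF-single j _ (λ i i≢j → u≈0 (Fin.suc i) (λ eq → i≢j (suc-injective eq)))))
          (+-identityˡ _)

  Assignment : Set
  Assignment = Fin n → Bool

  value : Form → Assignment → Carrier
  value = evalForm R

  value-cong : ∀ {u v : Form} {x y : Assignment} → (∀ i → u i ≈ v i) → (∀ i → x i ≡ y i) →
               value u x ≈ value v y
  value-cong u≈v x≡y = sumF-cong (λ i → *-cong (u≈v i) (reflexive (≡.cong (bit R) (x≡y i))))

  value-+ : ∀ (u v : Form) x → value (λ i → u i + v i) x ≈ value u x + value v x
  value-+ u v x =
    trans (sumF-cong (λ i → distribʳ _ (u i) (v i))) (sumF-+ (λ i → u i * bit R (x i)) (λ i → v i * bit R (x i)))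

  value-agree : ∀ (v : Form) x y → (∀ i → v i ≈ 0# ⊎ x i ≡ y i) → value v x ≈ value v y
  value-agree v x y agree = sumF-cong term
    where
    term : ∀ i → v i * bit R (x i) ≈ v i * bit R (y i)
    term i with agree i
    ... | inj₁ vᵢ≈0 = trans (*-cong vᵢ≈0 refl) (trans (zeroˡ _) (sym (trans (*-cong vᵢ≈0 refl) (zeroˡ _))))
    ... | inj₂ xᵢ≡yᵢ = reflexive (≡.cong (λ b → v i * bit R b) xᵢ≡yᵢ)

  value-allFalse : ∀ (v : Form) → value v (λ _ → false) ≈ 0#
  value-allFalse v = sumF-zero _ (λ i → zeroʳ (v i))

  assignments-complete : ∀ m (x : Fin m → Bool) → Any (λ y → ∀ i → y i ≡ x i) (assignments R m)
  assignments-complete zero    x = here (λ ())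
  assignments-complete (suc m) x with x Fin.zero in eq
  ... | false = Anyₚ.concat⁺ (Anyₚ.map⁺ (Any.map
                  (λ y≡x → here λ { Fin.zero → ≡.sym eq ; (Fin.suc i) → y≡x i })
                  (assignments-complete m (λ i → x (Fin.suc i)))))
  ... | true  = Anyₚ.concat⁺ (Anyₚ.map⁺ (Any.map
                  (λ y≡x → there (here λ { Fin.zero → ≡.sym eq ; (Fin.suc i) → y≡x i }))
                  (assignments-complete m (λ i → x (Fin.suc i)))))

  IsValue : Form → Carrier → Set ℓ
  IsValue v C = Any (λ x → value v x ≈ C) (assignments R n)

  isValue? : ∀ v C → Dec (IsValue v C)
  isValue? v C = any? (λ x → value v x ≟ C) (assignments R n)

  IsValue-resp : ∀ {v C C′} → C ≈ C′ → IsValue v C → IsValue v C′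
  IsValue-resp C≈C′ = Any.map (λ v≈C → trans v≈C C≈C′)

  isValue-at : ∀ v x → IsValue v (value v x)
  isValue-at v x = Any.map (λ y≡x → value-cong (λ _ → refl) y≡x) (assignments-complete n x)


module Restriction {c ℓ : Level} (R : FiniteRing c ℓ) (n : ℕ) (f : Fin n → FiniteRing.Carrier R) where
  open import Data.Nat using (_≤_)
  open import Data.Bool using (Bool; true; false; if_then_else_; _∧_)
  open import Data.List using (List; length; filter)
  open import Data.List.Properties using (length-filter)
  import Data.List.Relation.Unary.Any as Any
  import Data.List.Relation.Unary.Any.Properties as Anyₚ
  open import Data.Product using (∃; _×_; _,_; proj₁; proj₂)
  open import Data.Sum using (_⊎_; inj₁; inj₂)
  open import Relation.Binary.PropositionalEquality as ≡ using (_≡_)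
  import Data.List.Membership.Setoid.Properties as MembershipProperties
  open FiniteRing R hiding (zero)
  open ClauseCalculus R n
  open Evaluation R n
  open MembershipProperties using (∈-resp-≈; ∈-filter⁺; ∈-filter⁻)

  im₂ : List Carrier
  im₂ = im2 R f

  value∈im₂ : ∀ x → value f x ∈ᵥ im₂
  value∈im₂ x = Anyₚ.deduplicate⁺ _≟_ (λ A≈B C≈A → trans C≈A (sym A≈B))
    (Anyₚ.map⁺ (Any.map (λ y≡x → value-cong (λ _ → refl) (λ i → ≡.sym (y≡x i))) (assignments-complete n x)))

  im₂-sound : ∀ {C} → C ∈ᵥ im₂ → IsValue f C
  im₂-sound C∈ = Any.map sym (Anyₚ.map⁻ (Anyₚ.deduplicate⁻ _≟_ C∈))

  -- The values of v that are values of f.  Being a sublist of im₂(f) there are at most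
  -- d_f of them; for restrictions of f they are all the values of v.
  values : Form → List Carrier
  values v = filter (isValue? v) im₂

  values-sound : ∀ {v C} → C ∈ᵥ values v → IsValue v C
  values-sound {v} C∈ = proj₂ (∈-filter⁻ setoid (isValue? v) IsValue-resp {xs = im₂} C∈)

  values⊆im₂ : ∀ {v C} → C ∈ᵥ values v → C ∈ᵥ im₂
  values⊆im₂ {v} C∈ = proj₁ (∈-filter⁻ setoid (isValue? v) IsValue-resp {xs = im₂} C∈)

  values⁺ : ∀ {v C} → C ∈ᵥ im₂ → IsValue v C → C ∈ᵥ values v
  values⁺ {v} = ∈-filter⁺ setoid (isValue? v) IsValue-resp

  length-values : ∀ v → length (values v) ≤ length im₂
  length-values v = length-filter (isValue? v) im₂

  restrict : (Fin n → Bool) → Form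
  restrict m i = if m i then f i else 0#

  value-restrict : ∀ m x → value (restrict m) x ≈ value f (λ i → m i ∧ x i)
  value-restrict m x = sumF-cong term
    where
    term : ∀ i → restrict m i * bit R (x i) ≈ f i * bit R (m i ∧ x i)
    term i with m i
    ... | true  = refl
    ... | false = trans (zeroˡ _) (sym (zeroʳ (f i)))

  values-complete : ∀ m x → value (restrict m) x ∈ᵥ values (restrict m)
  values-complete m x =
    values⁺ (∈-resp-≈ setoid (sym (value-restrict m x)) (value∈im₂ (λ i → m i ∧ x i))) (isValue-at (restrict m) x)

  zero∈values : ∀ m → 0# ∈ᵥ values (restrict m)
  zero∈values m = ∈-resp-≈ setoid (value-allFalse (restrict m)) (values-complete m (λ _ → false))

  data Piece : Bool → Bool → Bool → Set where
    none  : Piece false false false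
    left  : Piece true  true  false
    right : Piece true  false true

  Partition : (m m₁ m₂ : Fin n → Bool) → Set
  Partition m m₁ m₂ = ∀ i → Piece (m i) (m₁ i) (m₂ i)

  piece-sum : ∀ {b b₁ b₂} → Piece b b₁ b₂ → ∀ a →
              1# * (if b₁ then a else 0#) + 1# * (if b₂ then a else 0#) ≈ (if b then a else 0#)
  piece-sum none  a = trans (+-cong (*-identityˡ 0#) (*-identityˡ 0#)) (+-identityˡ 0#)
  piece-sum left  a = trans (+-cong (*-identityˡ a) (*-identityˡ 0#)) (+-identityʳ a)
  piece-sum right a = trans (+-cong (*-identityˡ 0#) (*-identityˡ a)) (+-identityˡ a)

  piece-left : ∀ {b b₁ b₂} → Piece b b₁ b₂ → ∀ a (u v : Bool) →
               (if b₁ then a else 0#) ≈ 0# ⊎ (if b₁ then u else v) ≡ u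
  piece-left none  a u v = inj₁ refl
  piece-left left  a u v = inj₂ ≡.refl
  piece-left right a u v = inj₁ refl

  piece-right : ∀ {b b₁ b₂} → Piece b b₁ b₂ → ∀ a (u v : Bool) →
                (if b₂ then a else 0#) ≈ 0# ⊎ (if b₁ then u else v) ≡ v
  piece-right none  a u v = inj₁ refl
  piece-right left  a u v = inj₁ refl
  piece-right right a u v = inj₂ ≡.refl

  module Split {m m₁ m₂ : Fin n → Bool} (part : Partition m m₁ m₂) where

    restrict-sum : ∀ i → 1# * restrict m₁ i + 1# * restrict m₂ i ≈ restrict m i
    restrict-sum i = piece-sum (part i) (f i)

    value-split : ∀ x → value (restrict m) x ≈ value (restrict m₁) x + value (restrict m₂) x
    value-split x = trans (value-cong split (λ _ → ≡.refl)) (value-+ (restrict m₁) (restrict m₂) x)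
      where
      split : ∀ i → restrict m i ≈ restrict m₁ i + restrict m₂ i
      split i = sym (trans (+-cong (sym (*-identityˡ _)) (sym (*-identityˡ _))) (restrict-sum i))

    sumset⁺ : ∀ {A B} → A ∈ᵥ values (restrict m₁) → B ∈ᵥ values (restrict m₂) → (A + B) ∈ᵥ values (restrict m)
    sumset⁺ A∈ B∈ with Any.satisfied (values-sound A∈) | Any.satisfied (values-sound B∈)
    ... | x , x↦A | y , y↦B = ∈-resp-≈ setoid z↦A+B (values-complete m z)
      where
      -- z agrees with x on m₁ and with y on m₂
      z : Assignment
      z i = if m₁ i then x i else y i
      z↦A+B : value (restrict m) z ≈ _
      z↦A+B = trans (value-split z)
        (+-cong (trans (value-agree (restrict m₁) z x (λ i → piece-left (part i) (f i) (x i) (y i))) x↦A)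
                (trans (value-agree (restrict m₂) z y (λ i → piece-right (part i) (f i) (x i) (y i))) y↦B))

    sumset⁻ : ∀ {C} → C ∈ᵥ values (restrict m) →
              ∃ λ A → ∃ λ B → A ∈ᵥ values (restrict m₁) × B ∈ᵥ values (restrict m₂) × C ≈ A + B
    sumset⁻ C∈ with Any.satisfied (values-sound C∈)
    ... | x , x↦C = value (restrict m₁) x , value (restrict m₂) x ,
                    values-complete m₁ x , values-complete m₂ x , trans (sym x↦C) (value-split x)

module DivideAndConquer {c ℓ : Level} (R : FiniteRing c ℓ) (n : ℕ) (f : Fin n → FiniteRing.Carrier R) where
  open import Level using () renaming (_⊔_ to _⊔ˡ_)
  import Data.Nat as ℕ
  open import Data.Nat using (zero; suc; _≤_; _<_; _≤?_; _<?_; _∸_; z≤n; s≤s)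
    renaming (_+_ to _+ℕ_; _*_ to _*ℕ_; _^_ to _^ℕ_)
  open import Data.Nat.Properties
    using (≤-trans; ≤-reflexive; ≤-refl; <-≤-trans; <⇒≱; ≮⇒≥; n<1+n; m≤m+n; n≤1+n; ≤-pred)
  import Data.Nat.Properties as ℕₚ
  open import Data.Nat.Tactic.RingSolver using (solve-∀)
  open import Data.Fin using (Fin; toℕ; fromℕ<)
  open import Data.Fin.Properties using (toℕ<n; toℕ-injective; toℕ-fromℕ<)
  open import Data.Bool using (Bool; true; false; if_then_else_; _∧_)
  open import Data.Bool.Properties using (∧-zeroʳ)
  open import Data.List using (List; []; _∷_; map; length)
  open import Data.List.Properties using (length-map)
  open import Data.List.Relation.Unary.Any as Any using (here; there)
  open import Data.Product using (Σ; ∃; _×_; _,_)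
  open import Data.Sum using (_⊎_; inj₁; inj₂)
  open import Relation.Nullary using (¬_; does; yes; no; contradiction)
  open import Relation.Nullary.Decidable using (dec-true; dec-false)
  open import Relation.Binary.PropositionalEquality as ≡ using (_≡_; _≢_)
  import Data.List.Membership.Setoid.Properties as MembershipProperties
  import Algebra.Properties.Ring as RingProperties
  open Arithmetic
  open FiniteRing R hiding (zero)
  open ClauseCalculus R n
  open Evaluation R n
  open Restriction R n f
  open MembershipProperties using (∈-resp-≈; ∈-length)
  open RingProperties ring using (-0#≈0#; -‿distribʳ-*)

  -- d = d_f bounds the number of values of every restriction of f; clauses in the
  -- construction have at most width = widthFor d equations.
  d : ℕ
  d = length im₂

  width : ℕ
  width = widthFor d

  open NodeCount width

  Im : Form → Cl
  Im v = map (v ≐_) (values v)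

  d≤width : d ≤ width
  d≤width = ≤-trans (m≤m+n d (d *ℕ d)) (≤-trans (n≤1+n _) (n≤1+n _))

  Im-fits : ∀ v → length (Im v) ≤ width
  Im-fits v = ≤-trans (≤-reflexive (length-map (v ≐_) (values v))) (≤-trans (length-values v) d≤width)

  2≤width : 2 ≤ width
  2≤width = s≤s (s≤s z≤n)

  interval : ℕ → ℕ → Fin n → Bool
  interval lo hi i = does (lo ≤? toℕ i) ∧ does (toℕ i <? hi)

  module _ {lo hi : ℕ} {i : Fin n} where
    inside : lo ≤ toℕ i → toℕ i < hi → interval lo hi i ≡ true
    inside lo≤i i<hi = ≡.cong₂ _∧_ (dec-true (lo ≤? toℕ i) lo≤i) (dec-true (toℕ i <? hi) i<hi)

    below : ¬ lo ≤ toℕ i → interval lo hi i ≡ false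
    below lo≰i = ≡.cong (_∧ does (toℕ i <? hi)) (dec-false (lo ≤? toℕ i) lo≰i)

    above : ¬ toℕ i < hi → interval lo hi i ≡ false
    above i≮hi = ≡.trans (≡.cong (does (lo ≤? toℕ i) ∧_) (dec-false (toℕ i <? hi) i≮hi)) (∧-zeroʳ _)

  interval-split : ∀ {lo mid hi} → lo ≤ mid → mid ≤ hi →
                   Partition (interval lo hi) (interval lo mid) (interval mid hi)
  interval-split {lo} {mid} {hi} lo≤mid mid≤hi i with toℕ i <? mid | lo ≤? toℕ i | toℕ i <? hi
  ... | yes i<mid | yes lo≤i | _
    rewrite inside {lo} {hi} lo≤i (<-≤-trans i<mid mid≤hi) | inside {lo} {mid} lo≤i i<mid
          | below {mid} {hi} (<⇒≱ i<mid) = left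
  ... | yes i<mid | no lo≰i | _
    rewrite below {lo} {hi} lo≰i | below {lo} {mid} lo≰i | below {mid} {hi} (<⇒≱ i<mid) = none
  ... | no i≮mid | _ | yes i<hi
    rewrite inside {lo} {hi} (≤-trans lo≤mid (≮⇒≥ i≮mid)) i<hi | above {lo} {mid} i≮mid
          | inside {mid} {hi} (≮⇒≥ i≮mid) i<hi = right
  ... | no i≮mid | _ | no i≮hi
    rewrite above {lo} {hi} i≮hi | above {lo} {mid} i≮mid | above {mid} {hi} i≮hi = none

  point : Fin n → Fin n → Bool
  point j = interval (toℕ j) (suc (toℕ j))

  point-self : ∀ j → point j j ≡ true
  point-self j = inside {toℕ j} {suc (toℕ j)} ≤-refl (n<1+n (toℕ j))

  point-other : ∀ {i j} → i ≢ j → point j i ≡ false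
  point-other {i} {j} i≢j with toℕ j ≤? toℕ i | toℕ i <? suc (toℕ j)
  ... | no j≰i | _       = below {toℕ j} {suc (toℕ j)} j≰i
  ... | yes _  | no i≮j′ = above {toℕ j} {suc (toℕ j)} i≮j′
  ... | yes j≤i | yes i<j′ = contradiction (toℕ-injective (ℕₚ.≤-antisym (≤-pred i<j′) j≤i)) i≢j

  var-self : ∀ {m} (j : Fin m) → var R j j ≡ 1#
  var-self Fin.zero    = ≡.refl
  var-self (Fin.suc j) = var-self j

  var-other : ∀ {m} {i j : Fin m} → i ≢ j → var R j i ≡ 0#
  var-other {i = Fin.zero}  {Fin.zero}  i≢j = contradiction ≡.refl i≢j
  var-other {i = Fin.suc i} {Fin.zero}  i≢j = ≡.refl
  var-other {i = Fin.zero}  {Fin.suc j} i≢j = ≡.refl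
  var-other {i = Fin.suc i} {Fin.suc j} i≢j = var-other (λ i≡j → i≢j (≡.cong Fin.suc i≡j))

  -- A single variable: Im(f_j x_j) = (f_j x_j = 0 ∨ f_j x_j = f_j) follows from the
  -- boolean axiom  x_j = 0 ∨ x_j = 1  by scaling each of its equations by f_j.
  module SingleVariable (j : Fin n) where
    v : Form
    v = restrict (point j)

    v-self : v j ≈ f j
    v-self = reflexive (≡.cong (λ b → if b then f j else 0#) (point-self j))

    v-other : ∀ {i} → i ≢ j → v i ≈ 0#
    v-other {i} i≢j = reflexive (≡.cong (λ b → if b then f i else 0#) (point-other i≢j))

    value-v : ∀ x → value v x ≈ f j * bit R (x j)
    value-v x = trans (sumF-single j _ (λ i i≢j → trans (*-cong (v-other i≢j) refl) (zeroˡ _))) (*-cong v-self refl)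

    bit-cases : ∀ b → f j * bit R b ≈ 0# ⊎ f j * bit R b ≈ f j
    bit-cases false = inj₁ (zeroʳ (f j))
    bit-cases true  = inj₂ (*-identityʳ (f j))

    values-v : ∀ {C} → C ∈ᵥ values v → C ≈ 0# ⊎ C ≈ f j
    values-v C∈ with Any.satisfied (values-sound C∈)
    ... | x , x↦C with bit-cases (x j)
    ...   | inj₁ ≈0  = inj₁ (trans (sym x↦C) (trans (value-v x) ≈0))
    ...   | inj₂ ≈fⱼ = inj₂ (trans (sym x↦C) (trans (value-v x) ≈fⱼ))

    fⱼ∈values : f j ∈ᵥ values v
    fⱼ∈values = ∈-resp-≈ setoid (trans (value-v (λ _ → true)) (*-identityʳ (f j)))
                                (values-complete (point j) (λ _ → true))

    x=0 x=1 fx=0 fx=fⱼ : Eq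
    x=0  = mkEqn (var R j) 0#
    x=1  = mkEqn (var R j) (- 1#)
    fx=0  = lincomb R (f j) x=0 0# x=0
    fx=fⱼ = lincomb R (f j) x=1 0# x=1

    scaled-coeffs : ∀ i → f j * var R j i + 0# * var R j i ≈ v i
    scaled-coeffs i with i Data.Fin.≟ j
    ... | yes ≡.refl = trans (+-cong (trans (*-cong refl (reflexive (var-self j))) (*-identityʳ _)) (zeroˡ _))
                             (trans (+-identityʳ _) (sym v-self))
    ... | no i≢j     = trans (+-cong (trans (*-cong refl (reflexive (var-other i≢j))) (zeroʳ _)) (zeroˡ _))
                             (trans (+-identityʳ _) (sym (v-other i≢j)))

    fx=0≈ : _≈E_ R fx=0 (v ≐ 0#)
    fx=0≈ = scaled-coeffs , trans (+-cong (zeroʳ _) (zeroˡ _)) (trans (+-identityʳ 0#) (sym -0#≈0#))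

    fx=fⱼ≈ : _≈E_ R fx=fⱼ (v ≐ f j)
    fx=fⱼ≈ = scaled-coeffs ,
             trans (+-cong (trans (sym (-‿distribʳ-* (f j) 1#)) (-‿cong (*-identityʳ _))) (zeroˡ _)) (+-identityʳ _)

    Im-v≈ : Im v ≈ᶜ (fx=fⱼ ∷ fx=0 ∷ [])
    Im-v≈ = ⊆-antisym (≐⊆ v by-value)
      (∷⊆ (∈-resp-≈ eqnSetoid (≈ₑ-sym fx=fⱼ≈) (∈-≐⁺ v fⱼ∈values))
          (∷⊆ (∈-resp-≈ eqnSetoid (≈ₑ-sym fx=0≈) (∈-≐⁺ v (zero∈values (point j)))) []⊆))
      where
      by-value : ∀ {C} → C ∈ᵥ values v → (v ≐ C) ∈ₑ (fx=fⱼ ∷ fx=0 ∷ [])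
      by-value C∈ with values-v C∈
      ... | inj₁ C≈0  = there (here (≈ₑ-trans (≐-cong v C≈0) (≈ₑ-sym fx=0≈)))
      ... | inj₂ C≈fⱼ = here (≈ₑ-trans (≐-cong v C≈fⱼ) (≈ₑ-sym fx=fⱼ≈))

    -- Seven nodes: two scalings, each resolving two copies of its premise.
    single : Deriv (Im v) 7
    single = scaleRule (f j) swap Im-v≈ (Im-fits v)
               (scaleRule (f j) ≈ᶜ-refl ≈ᶜ-refl 2≤width (byAxiom j 2≤width))
      where
      swap : (fx=0 ∷ x=1 ∷ []) ≈ᶜ (x=1 ∷ fx=0 ∷ [])
      swap = ⊆-antisym (∷⊆ (there ∈-head) (∷⊆ ∈-head []⊆)) (∷⊆ (there ∈-head) (∷⊆ ∈-head []⊆))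

  slack budget growth : ℕ
  slack  = slackFor d
  budget = budgetFor d
  growth = 2 ^ℕ levelExp d

  Within : (Fin n → Bool) → ℕ → Set (c ⊔ˡ ℓ)
  Within m B = ∃ λ N → Deriv (Im (restrict m)) N × N +ℕ slack ≤ B

  Within-mono : ∀ {m B B′} → B ≤ B′ → Within m B → Within m B′
  Within-mono B≤B′ (N , π , N+slack≤B) = N , π , ≤-trans N+slack≤B B≤B′

  combineValues : ∀ {g h gh : Form} (S T U : List Carrier) {N B} →
    (∀ i → 1# * g i + 1# * h i ≈ gh i) →
    (∀ {A B} → A ∈ᵥ S → B ∈ᵥ T → (A + B) ∈ᵥ U) →
    (∀ {C} → C ∈ᵥ U → ∃ λ A → ∃ λ B → A ∈ᵥ S × B ∈ᵥ T × C ≈ A + B) →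
    0# ∈ᵥ S → 0# ∈ᵥ T → length S ≤ d → length T ≤ d → length U ≤ d → N +ℕ slack ≤ B →
    Deriv (map (g ≐_) S) N → Deriv (map (h ≐_) T) N →
    ∃ λ M → Deriv (map (gh ≐_) U) M × M +ℕ slack ≤ growth *ℕ B
  combineValues []       _        _ _ _ _ ()
  combineValues (_ ∷ _)  []       _ _ _ _ _ ()
  combineValues (s₀ ∷ S′) (t₀ ∷ T′) U {N} {B} g+h sum⁺ sum⁻ _ _ S≤d T≤d U≤d N+slack≤B πX πY =
    _ , combine g+h s₀ S′ t₀ T′ wide πX πY U≈ U-fits ,
    levelStep (length S′) (length T) N slack B growth (s≤s z≤n) slack-ok p≤growth N+slack≤B
    where
    open Combination R n width using (_⊕_; ∈-⊕⁺; ∈-⊕⁻; combine)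
    S T : List Carrier
    S = s₀ ∷ S′
    T = t₀ ∷ T′
    U-fits : length (map (_ ≐_) U) ≤ width
    U-fits = ≤-trans (≤-reflexive (length-map _ U)) (≤-trans U≤d d≤width)
    wide : suc (length S +ℕ length S *ℕ length T) ≤ width
    wide = ≤-trans (s≤s (ℕₚ.+-mono-≤ S≤d (ℕₚ.*-mono-≤ S≤d T≤d))) (n≤1+n _)
    U≈ : map (_ ≐_) U ≈ᶜ map (_ ≐_) (S ⊕ T)
    U≈ = ⊆-antisym (≐-mono _ U⊆S⊕T) (≐-mono _ S⊕T⊆U)
      where
      U⊆S⊕T : U ⊆ᵥ (S ⊕ T)
      U⊆S⊕T C∈ with sum⁻ C∈
      ... | A , B , A∈ , B∈ , C≈ = ∈-resp-≈ setoid (sym C≈) (∈-⊕⁺ A∈ B∈)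
      S⊕T⊆U : (S ⊕ T) ⊆ᵥ U
      S⊕T⊆U C∈ with ∈-⊕⁻ S T C∈
      ... | A , B , A∈ , B∈ , C≈ = ∈-resp-≈ setoid (sym C≈) (sum⁺ A∈ B∈)
    S′≤d∸1 : length S′ ≤ d ∸ 1
    S′≤d∸1 = ℕₚ.∸-monoˡ-≤ 1 S≤d
    slack-ok : 2 ^ℕ length S′ *ℕ (length T +ℕ 3) ≤ slack
    slack-ok = ℕₚ.*-mono-≤ (ℕₚ.^-monoʳ-≤ 2 (≤-trans (n≤1+n _) S≤d)) (ℕₚ.+-monoˡ-≤ 3 T≤d)
    p≤growth : 2 ^ℕ length S′ *ℕ suc (length T) ≤ growth
    p≤growth = ≤-trans (ℕₚ.*-monoʳ-≤ (2 ^ℕ length S′) (suc≤2^ (length T)))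
                 (≤-trans (≤-reflexive (≡.sym (ℕₚ.^-distribˡ-+-* 2 (length S′) (length T))))
                          (ℕₚ.^-monoʳ-≤ 2 (ℕₚ.+-mono-≤ S′≤d∸1 T≤d)))

  merge : ∀ {m m₁ m₂ B} → Partition m m₁ m₂ → Within m₁ B → Within m₂ B → Within m (growth *ℕ B)
  merge {m} {m₁} {m₂} part (N₁ , π₁ , b₁) (N₂ , π₂ , b₂) =
    combineValues (values (restrict m₁)) (values (restrict m₂)) (values (restrict m))
      restrict-sum sumset⁺ sumset⁻ (zero∈values m₁) (zero∈values m₂)
      (length-values _) (length-values _) (length-values _)
      (≤-trans (≤-reflexive (ℕₚ.+-distribʳ-⊔ slack N₁ N₂)) (ℕₚ.⊔-lub b₁ b₂))
      (raise (ℕₚ.m≤m⊔n N₁ N₂) π₁) (raise (ℕₚ.m≤n⊔m N₁ N₂) π₂)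
    where open Split part

  growth-pos : 1 ≤ growth
  growth-pos = ℕₚ.m^n>0 2 (levelExp d)

  -- Every interval [lo, hi) of length at most 2ᵏ satisfies the invariant with bound
  -- budget · growthᵏ, by induction on k: single variables directly; an interval longer
  -- than 2ᵏ⁻¹ is split after its first 2ᵏ⁻¹ variables and the halves are merged.
  build : ∀ k lo hi → lo < hi → hi ≤ lo +ℕ 2 ^ℕ k → hi ≤ n →
          Within (interval lo hi) (budget *ℕ growth ^ℕ k)
  build zero lo hi lo<hi hi≤lo+1 hi≤n =
    ≡.subst₂ (λ a b → Within (interval a b) (budget *ℕ 1)) (toℕ-fromℕ< lo<n) suc-j≡hi
      (7 , SingleVariable.single j , ≤-reflexive (≡.sym (ℕₚ.*-identityʳ budget)))
    where
    lo<n : lo < n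
    lo<n = <-≤-trans lo<hi hi≤n
    j : Fin n
    j = fromℕ< lo<n
    suc-j≡hi : suc (toℕ j) ≡ hi
    suc-j≡hi = ≡.trans (≡.cong suc (toℕ-fromℕ< lo<n))
                 (ℕₚ.≤-antisym lo<hi (≤-trans hi≤lo+1 (≤-reflexive (ℕₚ.+-comm lo 1))))
  build (suc k) lo hi lo<hi hi≤ hi≤n with hi ≤? lo +ℕ 2 ^ℕ k
  ... | yes short = Within-mono (ℕₚ.*-monoʳ-≤ budget growth^k≤) (build k lo hi lo<hi short hi≤n)
    where
    growth^k≤ : growth ^ℕ k ≤ growth ^ℕ suc k
    growth^k≤ = ℕₚ.m≤n*m (growth ^ℕ k) growth {{ℕ.>-nonZero growth-pos}}
  ... | no  long  = Within-mono (≤-reflexive (reorder growth budget (growth ^ℕ k)))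
                      (merge (interval-split (ℕₚ.<⇒≤ lo<mid) (ℕₚ.<⇒≤ mid<hi))
                             (build k lo mid lo<mid ≤-refl (≤-trans (ℕₚ.<⇒≤ mid<hi) hi≤n))
                             (build k mid hi mid<hi hi≤mid+2^k hi≤n))
    where
    mid : ℕ
    mid = lo +ℕ 2 ^ℕ k
    lo<mid : lo < mid
    lo<mid = ℕₚ.m<m+n lo (ℕₚ.m^n>0 2 k)
    mid<hi : mid < hi
    mid<hi = ℕₚ.≰⇒> long
    hi≤mid+2^k : hi ≤ mid +ℕ 2 ^ℕ k
    hi≤mid+2^k = ≤-trans hi≤ (≤-reflexive (halves lo (2 ^ℕ k)))
      where
      halves : ∀ lo h → lo +ℕ 2 *ℕ h ≡ lo +ℕ h +ℕ h
      halves = solve-∀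
    reorder : ∀ g b x → g *ℕ (b *ℕ x) ≡ b *ℕ (g *ℕ x)
    reorder = solve-∀

  everything : Fin n → Bool
  everything = interval 0 n

  restrict-everything : ∀ i → restrict everything i ≈ f i
  restrict-everything i =
    reflexive (≡.cong (λ b → if b then f i else 0#) (inside {0} {n} {i} z≤n (toℕ<n i)))

  Im-everything : Im (restrict everything) ≈ᶜ ImClause R f
  Im-everything = ⊆-antisym
    (≐⊆ _ λ {C} C∈ → ∈-resp-≈ eqnSetoid (≈ₑ-sym (same C)) (∈-≐⁺ f (values⊆im₂ C∈)))
    (≐⊆ f λ {C} C∈ → ∈-resp-≈ eqnSetoid (same C) (∈-≐⁺ _ (values⁺ C∈ (is-value C∈))))
    where
    same : ∀ C → _≈E_ R (restrict everything ≐ C) (f ≐ C)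
    same C = restrict-everything , refl
    is-value : ∀ {C} → C ∈ᵥ im₂ → IsValue (restrict everything) C
    is-value C∈ = Any.map (trans (value-cong restrict-everything (λ _ → ≡.refl))) (im₂-sound C∈)

  -- 0 is a value of f, so d_f ≥ 1.
  1≤d : 1 ≤ d
  1≤d = ∈-length setoid (values⊆im₂ (zero∈values everything))

  size-estimate : ∀ {K k N} → boundConstant d ≤ K → 1 ≤ n → 2 ^ℕ k ≤ 2 *ℕ n →
                  N +ℕ slack ≤ budget *ℕ growth ^ℕ k → suc N *ℕ clauseBound ≤ K *ℕ sF R f *ℕ n ^ℕ (2 *ℕ d)
  size-estimate {K} {k} {N} d≤K 1≤n 2^k≤2n N+slack≤ = begin
    suc N *ℕ clauseBound
      ≤⟨ ℕₚ.*-monoˡ-≤ clauseBound suc-N≤ ⟩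
    budget *ℕ growth ^ℕ k *ℕ (width *ℕ eqnSizeBound)
      ≡⟨ ℕₚ.*-comm (budget *ℕ growth ^ℕ k) _ ⟩
    width *ℕ eqnSizeBound *ℕ (budget *ℕ growth ^ℕ k)
      ≤⟨ finalBound n k (levelExp d) width budget K (sF R f) 1≤n 2^k≤2n d≤K 1≤sF ⟩
    K *ℕ sF R f *ℕ n ^ℕ suc (levelExp d)
      ≡⟨ ≡.cong (λ e → K *ℕ sF R f *ℕ n ^ℕ e) exponent ⟩
    K *ℕ sF R f *ℕ n ^ℕ (2 *ℕ d) ∎
    where
    open ℕₚ.≤-Reasoning
    1≤sF : 1 ≤ sF R f
    1≤sF = clauseSize-pos (ImClause R f) (≤-trans 1≤d (≤-reflexive (≡.sym (length-map _ im₂))))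
    1≤slack : 1 ≤ slack
    1≤slack = ℕₚ.*-mono-≤ (ℕₚ.m^n>0 2 d) (≤-trans (s≤s z≤n) (ℕₚ.m≤n+m 3 d))
    suc-N≤ : suc N ≤ budget *ℕ growth ^ℕ k
    suc-N≤ = ≤-trans (≤-reflexive (ℕₚ.+-comm 1 N)) (≤-trans (ℕₚ.+-monoʳ-≤ N 1≤slack) N+slack≤)
    exponent : suc (levelExp d) ≡ 2 *ℕ d
    exponent = ≡.trans (≡.cong (_+ℕ d) (ℕₚ.suc-pred d {{ℕ.>-nonZero 1≤d}}))
                       (≡.cong (d +ℕ_) (≡.sym (ℕₚ.+-identityʳ d)))

  Im-derivation : ∀ K → boundConstant d ≤ K → 1 ≤ n →
            Σ (TreeDeriv R (ImClause R f)) λ π → derivSize R π ≤ K *ℕ sF R f *ℕ n ^ℕ (2 *ℕ dF R f)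
  Im-derivation K d≤K 1≤n with ceilLog₂ n 1≤n
  ... | k , n≤2^k , 2^k≤2n with build k 0 n 1≤n n≤2^k ≤-refl
  ...   | N , π , N+slack≤ =
    Deriv.tree π′ , ≤-trans (Deriv.bounded π′) (size-estimate {K} {k} d≤K 1≤n 2^k≤2n N+slack≤)
    where
    π′ : Deriv (ImClause R f) (suc N)
    π′ = relabel Im-everything (≤-trans (≤-reflexive (length-map _ im₂)) d≤width) π

-- d_f ≤ |R|: the image list has no repeated values, and all of them are among the
-- |R| enumerated ring elements.
module ImageBound {c ℓ : Level} (R : FiniteRing c ℓ) where
  open import Data.Nat using (_≤_; z≤n; s≤s)
  open import Data.Nat.Properties using (≤-trans; ≤-reflexive)
  open import Data.List using (List; []; _∷_; length; tabulate)
  open import Data.List.Properties using (length-removeAt′; length-tabulate)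
  open import Data.List.Relation.Unary.Any using (here; there; index)
  open import Data.List.Relation.Unary.All using (All; _∷_)
  open import Data.List.Relation.Unary.AllPairs using (_∷_)
  open import Data.Product using (_,_)
  open import Relation.Nullary using (¬_; contradiction)
  open import Relation.Binary.Bundles using (DecSetoid)
  open import Relation.Binary.PropositionalEquality as ≡ using (_≡_)
  import Data.List.Membership.Setoid as Membership
  import Data.List.Membership.Setoid.Properties as MembershipProperties
  import Data.List.Relation.Binary.Subset.Setoid as Subset
  import Data.List.Relation.Unary.Unique.Setoid as UniqueSetoid
  import Data.List.Relation.Unary.Unique.DecSetoid.Properties as UniqueProperties
  open FiniteRing R hiding (zero)
  open Membership setoid using (_∈_; _─_)
  open Subset setoid using (_⊆_)
  open UniqueSetoid setoid using (Unique)
  open MembershipProperties using (∈-resp-≈; ∈-tabulate⁺)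

  ∈-─ : ∀ {x y} (E : List Carrier) (x∈E : x ∈ E) → y ∈ E → ¬ y ≈ x → y ∈ (E ─ x∈E)
  ∈-─ (e ∷ E) (here x≈e)  (here y≈e)  y≉x = contradiction (trans y≈e (sym x≈e)) y≉x
  ∈-─ (e ∷ E) (here _)    (there y∈E) _   = y∈E
  ∈-─ (e ∷ E) (there _)   (here y≈e)  _   = here y≈e
  ∈-─ (e ∷ E) (there x∈E) (there y∈E) y≉x = there (∈-─ E x∈E y∈E y≉x)

  distinct : ∀ {x y L} → All (λ z → ¬ x ≈ z) L → y ∈ L → ¬ y ≈ x
  distinct (x≉z ∷ _)  (here y≈z)  y≈x = x≉z (trans (sym y≈x) y≈z)
  distinct (_ ∷ x≉L) (there y∈L) y≈x = distinct x≉L y∈L y≈x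

  unique-length : ∀ {L} E → Unique L → L ⊆ E → length L ≤ length E
  unique-length {[]}    E _               _   = z≤n
  unique-length {x ∷ L} E (x≉L ∷ unique) L⊆E =
    ≤-trans (s≤s (unique-length (E ─ x∈E) unique L⊆E─x))
            (≤-reflexive (≡.sym (length-removeAt′ E (index x∈E))))
    where
    x∈E : x ∈ E
    x∈E = L⊆E (here refl)
    L⊆E─x : L ⊆ (E ─ x∈E)
    L⊆E─x y∈L = ∈-─ E x∈E (L⊆E (there y∈L)) (distinct x≉L y∈L)

  decSetoid : DecSetoid c ℓ
  decSetoid = record { isDecEquivalence = record { isEquivalence = isEquivalence ; _≟_ = _≟_ } }

  dF≤card : ∀ {n} (f : Fin n → Carrier) → dF R f ≤ card
  dF≤card f = ≤-trans
    (unique-length (tabulate enum) (UniqueProperties.deduplicate-! decSetoid _) enumerated)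
    (≤-reflexive (length-tabulate enum))
    where
    enumerated : ∀ {y} → y ∈ im2 R f → y ∈ tabulate enum
    enumerated {y} _ with enum-surj y
    ... | i , enum-i≈y = ∈-resp-≈ setoid enum-i≈y (∈-tabulate⁺ setoid i)

open import Data.Nat using (_*_; _^_; _≤_)
open import Data.Product using (Σ; ∃; _,_)
open Arithmetic using (boundConstant; boundConstant-mono)

-- The main theorem: K = boundConstant |R| dominates boundConstant d_f because d_f ≤ |R|,
-- so the divide-and-conquer derivation of Im(f) has size at most K · s_f · n^{2 d_f}.
mainTheorem19 : ∀ {c ℓ : Level} (R : FiniteRing c ℓ) →
    ∃ λ (K : ℕ) → ∀ (n : ℕ) → 1 ≤ n → (f : Fin n → FiniteRing.Carrier R) →
    Σ (TreeDeriv R (ImClause R f)) λ π →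
    derivSize R π ≤ K * sF R f * n ^ (2 * dF R f)
mainTheorem19 R = boundConstant (FiniteRing.card R) , λ n 1≤n f →
  DivideAndConquer.Im-derivation R n f _ (boundConstant-mono (ImageBound.dF≤card R f)) 1≤n
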